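{- For every $\{1,3\}$-tree $T$ there is a bijection between the vertices of $\mathcal{P}_T$ and the subsets of the set of leaves of $T$ having an even number of elements. Consequently, if $T$ has $m$ edges, then $\mathcal{P}_T$ has $2^{\frac{m+1}{2}}$ vertices.
   Context: A $\{1,3\}$-tree is a finite tree all of whose nodes have degree $1$ (leaves) or $3$ (internal nodes). With $E$ the edge set, $\mathcal{P}_T\subset\mathbb{R}^E$ is the set of $w$ such that for every internal node $v$ with incident edges $a,b,c$: $w_a\le w_b+w_c$, $w_b\le w_a+w_c$, $w_c\le w_a+w_b$, $w_a+w_b+w_c\le1$; and if $T$ is a single edge $e$, $\mathcal{P}_T=\{w:0\le w_e\le\frac12\}$.
   Formalization: The points of $\mathcal{P}_T$ have rational coordinates, lying in ℚ^E rather than $\mathbb{R}^E$, and its vertices are the extreme points among these rational points. -}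

module Defs where

open import Data.Nat as ℕ using (ℕ; suc; zero; _^_)
open import Data.Nat.Divisibility using (_∣_)
open import Data.Fin using (Fin)
open import Data.Fin.Properties using (_≟_)
open import Data.Fin.Subset using (Subset; inside; outside; ∣_∣; _∈_)
open import Data.Vec using (Vec; tabulate; lookup)
open import Data.List using (List; []; _∷_; length)
open import Data.List.Relation.Unary.Unique.Propositional using (Unique)
open import Data.Bool using (if_then_else_; _∨_)
open import Data.Rational as ℚ using (ℚ; 0ℚ; 1ℚ; ½)
open import Data.Product using (Σ; _×_; proj₁)
open import Relation.Nullary.Decidable using (⌊_⌋)
open import Relation.Nullary using (¬_)
open import Relation.Binary.PropositionalEquality using (_≡_; _≢_)

record Graph : Set where
  field
    n m : ℕ
    src tgt : Fin m → Fin n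

module _ (G : Graph) where
  open Graph G

  data Walk : Fin n → Fin n → Set where
    nil : ∀ {v} → Walk v v
    fwd : ∀ {w} (e : Fin m) → Walk (tgt e) w → Walk (src e) w
    bwd : ∀ {w} (e : Fin m) → Walk (src e) w → Walk (tgt e) w

  walkEdges : ∀ {u v} → Walk u v → List (Fin m)
  walkEdges nil = []
  walkEdges (fwd e p) = e ∷ walkEdges p
  walkEdges (bwd e p) = e ∷ walkEdges p

  Connected : Set
  Connected = ∀ u v → Walk u v

  Acyclic : Set
  Acyclic = ∀ v (p : Walk v v) → Unique (walkEdges p) → length (walkEdges p) ≡ 0

  IsTree : Set
  IsTree = (1 ℕ.≤ n) × Connected × Acyclic

  incident : Fin n → Subset m
  incident v = tabulate (λ e → if ⌊ src e ≟ v ⌋ ∨ ⌊ tgt e ≟ v ⌋ then inside else outside)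

  degree : Fin n → ℕ
  degree v = ∣ incident v ∣

  Is13Tree : Set
  Is13Tree = IsTree × (∀ v → degree v ≡ 1 Data.Sum.⊎ degree v ≡ 3)
    where import Data.Sum

  IsLeaf : Fin n → Set
  IsLeaf v = degree v ≡ 1

  IsInternal : Fin n → Set
  IsInternal v = degree v ≡ 3

  NodeConstraints : Vec ℚ m → Set
  NodeConstraints w = ∀ v → IsInternal v → ∀ a b c →
    a ∈ incident v → b ∈ incident v → c ∈ incident v →
    a ≢ b → b ≢ c → a ≢ c →
    let wa = lookup w a ; wb = lookup w b ; wc = lookup w c in
    (wa ℚ.≤ wb ℚ.+ wc) × (wb ℚ.≤ wa ℚ.+ wc) × (wc ℚ.≤ wa ℚ.+ wb) ×
    (wa ℚ.+ wb ℚ.+ wc ℚ.≤ 1ℚ)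

  SingleEdge : Set
  SingleEdge = m ≡ 1

  InP : Vec ℚ m → Set
  InP w = NodeConstraints w ×
          (SingleEdge → ∀ e → (0ℚ ℚ.≤ lookup w e) × (lookup w e ℚ.≤ ½))

  IsVertex : Vec ℚ m → Set
  IsVertex w = InP w × (∀ x y t → InP x → InP y → 0ℚ ℚ.< t → t ℚ.< 1ℚ →
    (∀ i → lookup w i ≡ t ℚ.* lookup x i ℚ.+ (1ℚ ℚ.- t) ℚ.* lookup y i) → x ≡ y)

  VertexSet : Set
  VertexSet = Σ (Vec ℚ m) IsVertex

  EvenLeafSubset : Set
  EvenLeafSubset = Σ (Subset n) (λ S → (∀ v → v ∈ S → IsLeaf v) × (2 ∣ ∣ S ∣))

-- a bijection between A and B, where elements are compared by their first
-- components (the second components are proofs of membership)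
record Bij {P : Set} {Q : Set} (A : Set) (B : Set) (πA : A → P) (πB : B → Q) : Set where
  field
    to   : A → B
    from : B → A
    from-to : ∀ a → πA (from (to a)) ≡ πA a
    to-from : ∀ b → πB (to (from b)) ≡ πB b

{-# OPTIONS --safe #-}
module Submission where

-- The four inequalities at an internal node cut out a tetrahedron whose vertices are the
-- points of {0, ½}³ with an even number of ½'s, and every coordinate of a point of P_T lies
-- in [0, ½].  Hence a half-integral point ½·𝟙_J of P_T is a vertex, and it lies in P_T iff J
-- has even degree at every internal node.  Conversely, if a coordinate of w ∈ P_T lies strictly
-- between 0 and ½, choose at every node, from a root outwards and compatibly along edges, a
-- vertex of the local tetrahedron lying on every facet that contains the local point of w.
-- This yields a half-integral u ∈ P_T satisfying with equality every constraint that is tight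
-- at w, so w ± ε(w − u) ∈ P_T for small ε > 0 and w is not a vertex.  In a tree the boundary
-- map J ↦ ∂J (the vertices of odd J-degree) is a bijection from edge sets onto even vertex
-- sets; its inverse sends S to the set of edges separating an odd number of vertices of S from
-- the root.  So vertices correspond to even sets of leaves.  Finally n = m + 1 and the
-- handshake lemma give (m + 3)/2 leaves, and an ℓ-element set has 2^(ℓ−1) even subsets.

open import Defs
open import Algebra.Bundles using (Monoid; CommutativeMonoid; CommutativeRing; Semiring)
import Algebra.Properties.CommutativeMonoid.Sum as CommutativeMonoidSum
import Algebra.Properties.Monoid.Sum as MonoidSum
import Algebra.Properties.Semiring.Sum as SemiringSum
open import Data.Bool.Base using (Bool; true; false; not; _∧_; _∨_; _xor_; if_then_else_)
open import Data.Bool.Properties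
  using ( xor-∧-commutativeRing; xor-same; xor-comm; xor-assoc; xor-identityʳ; xor-annihilates-not
        ; ∨-zeroʳ; ∧-comm; ∧-zeroʳ; ∧-distribˡ-xor; ∧-distribʳ-xor)
import Data.Bool.Solver
open import Data.Empty using (⊥; ⊥-elim)
open import Data.Fin.Base using (Fin; zero; suc; fromℕ<; combine; remQuot; punchIn; punchOut)
open import Data.Fin.Properties
  using ( _≟_; suc-injective; 2↔Bool; remQuot-combine; combine-remQuot
        ; punchIn-punchOut; punchInᵢ≢i; punchIn-injective; injective⇒≤)
open import Data.Fin.Subset using (Subset; _∈_; _∉_; _⊆_; ∣_∣; inside; outside)
open import Data.Fin.Subset.Properties using (∣p∣≤n; _∈?_)
open import Data.Nat.Base as ℕ using (ℕ; zero; suc)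
import Data.Nat.Properties as ℕ
open import Data.Nat.Divisibility using (_∣_; divides)
open import Data.Product using (Σ; ∃; ∃₂; _×_; _,_; proj₁; proj₂)
open import Data.Sum using (_⊎_; inj₁; inj₂; [_,_]′)
open import Data.Vec.Base using (Vec; []; _∷_; lookup; tabulate; here; there)
open import Data.Vec.Properties using (lookup∘tabulate; tabulate∘lookup; tabulate-cong; []=⇒lookup; lookup⇒[]=)
open import Function.Base using (_∘_; id)
open import Function.Bundles using (_⇔_; mk⇔; Inverse; Equivalence)
open import Relation.Binary.PropositionalEquality
  using (_≡_; _≢_; refl; sym; trans; cong; cong₂; subst; subst₂; ≢-sym; module ≡-Reasoning)
open import Relation.Nullary using (¬_; Dec; does; yes; no; contradiction)
open import Relation.Nullary.Decidable using (dec-true; dec-false; does-⇔; isYes≗does; from-yes; from-no)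
open import Relation.Unary using (Decidable)
open import Level using (0ℓ)

module Combinatorics where

  open import Data.Fin.Subset using (_-_; ⁅_⁆)
  open import Data.Fin.Subset.Properties using (p─⊥≡p; p─q⊆p; drop-there) renaming (x∈p∧x≢y⇒x∈p-y to ∈-remove⁺)
  open import Data.Nat.Base using (_+_; _*_; _^_; pred)

  δ : ∀ {k} → Fin k → Fin k → Bool
  δ i j = does (i ≟ j)

  module _ {c ℓ} (M : Monoid c ℓ) where
    open Monoid M using (Carrier; _≈_; _∙_; ε; ∙-congˡ; identityˡ; identityʳ; setoid)
      renaming (trans to ≈-trans)
    open MonoidSum M using (sum; sum-replicate-zero)
    open import Relation.Binary.Reasoning.Setoid setoid

    sum-δ : ∀ {k} (j : Fin k) (f : Fin k → Carrier) → sum (λ i → if δ i j then f i else ε) ≈ f j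
    sum-δ {suc k} zero f = begin
      f zero ∙ sum {k} (λ _ → ε) ≈⟨ ∙-congˡ (sum-replicate-zero k) ⟩
      f zero ∙ ε                 ≈⟨ identityʳ (f zero) ⟩
      f zero                     ∎
    sum-δ {suc k} (suc j) f = ≈-trans (identityˡ _) (sum-δ j (f ∘ suc))

  vec-ext : ∀ {A : Set} {k} (xs ys : Vec A k) → (∀ i → lookup xs i ≡ lookup ys i) → xs ≡ ys
  vec-ext xs ys eq = trans (sym (tabulate∘lookup xs)) (trans (tabulate-cong eq) (tabulate∘lookup ys))

  δ-sym : ∀ {k} (i j : Fin k) → δ i j ≡ δ j i
  δ-sym i j = does-⇔ (mk⇔ sym sym) (i ≟ j) (j ≟ i)

  δ≡true⇒≡ : ∀ {k} {i j : Fin k} → δ i j ≡ true → i ≡ j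
  δ≡true⇒≡ {i = i} {j} eq with i ≟ j
  ... | yes i≡j = i≡j

  ∧≡true⇒ : ∀ {a b} → a ∧ b ≡ true → a ≡ true × b ≡ true
  ∧≡true⇒ {true} {true} _ = refl , refl

  ∧-as-if : ∀ b x → b ∧ x ≡ (if b then x else false)
  ∧-as-if true  x = refl
  ∧-as-if false x = refl

  xor≡false⇒≡ : ∀ {a b} → a xor b ≡ false → a ≡ b
  xor≡false⇒≡ {true}  {true}  _ = refl
  xor≡false⇒≡ {false} {false} _ = refl

  module ℕΣ = CommutativeMonoidSum ℕ.+-0-commutativeMonoid

  ∣S∣≡sum : ∀ {k} (S : Subset k) → ∣ S ∣ ≡ ℕΣ.sum (λ i → if lookup S i then 1 else 0)
  ∣S∣≡sum []            = refl
  ∣S∣≡sum (inside  ∷ S) = cong suc (∣S∣≡sum S)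
  ∣S∣≡sum (outside ∷ S) = ∣S∣≡sum S

  sum-const : ∀ {k} c → ℕΣ.sum {k} (λ _ → c) ≡ k * c
  sum-const {zero}  c = refl
  sum-const {suc k} c = cong (c +_) (sum-const {k} c)

  module ⊕ = SemiringSum (CommutativeRing.semiring xor-∧-commutativeRing)

  parity : ∀ {k} → (Fin k → Bool) → Bool
  parity = ⊕.sum

  parity-δ : ∀ {k} (j : Fin k) (f : Fin k → Bool) → parity (λ i → δ i j ∧ f i) ≡ f j
  parity-δ j f =
    trans (⊕.sum-cong-≗ (λ i → ∧-as-if (δ i j) (f i))) (sum-δ (CommutativeRing.+-monoid xor-∧-commutativeRing) j f)

  parity≡true⇒∃ : ∀ {k} (f : Fin k → Bool) → parity f ≡ true → ∃ λ i → f i ≡ true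
  parity≡true⇒∃ {suc k} f odd with f zero in f₀
  ... | true  = zero , f₀
  ... | false with parity≡true⇒∃ (f ∘ suc) odd
  ...   | i , fi = suc i , fi

  ∣S∣≡parity+2h : ∀ {k} (S : Subset k) → ∃ λ h → ∣ S ∣ ≡ (if parity (lookup S) then 1 else 0) + 2 * h
  ∣S∣≡parity+2h [] = 0 , refl
  ∣S∣≡parity+2h (s ∷ S) with ∣S∣≡parity+2h S
  ... | h , eq with s | parity (lookup S)
  ...   | false | _     = h , eq
  ...   | true  | false = h , cong suc eq
  ...   | true  | true  = suc h , cong suc (trans eq (sym (ℕ.+-suc h (h + 0))))

  even⇔parity≡false : ∀ {k} (S : Subset k) → 2 ∣ ∣ S ∣ ⇔ parity (lookup S) ≡ false
  even⇔parity≡false S with ∣S∣≡parity+2h S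
  ... | h , eq with parity (lookup S)
  ...   | false = mk⇔ (λ _ → refl) (λ _ → divides h (trans eq (ℕ.*-comm 2 h)))
  ...   | true  = mk⇔ (λ { (divides q eq′) → contradiction (trans (trans (ℕ.*-comm 2 q) (sym eq′)) eq) (ℕ.even≢odd q h) })
                      λ ()

  x∉p-x : ∀ {k} (p : Subset k) x → x ∉ p - x
  x∉p-x (_ ∷ p) zero    ()
  x∉p-x (_ ∷ p) (suc x) (there x∈p-x) = x∉p-x p x x∈p-x

  ∈-remove⁻ : ∀ {k} {p : Subset k} {x y} → y ∈ p - x → y ∈ p × y ≢ x
  ∈-remove⁻ {p = p} {x} y∈p-x = p─q⊆p p ⁅ x ⁆ y∈p-x , λ { refl → x∉p-x p x y∈p-x }

  ∣p∣≡1+∣p-x∣ : ∀ {k} {p : Subset k} {x} → x ∈ p → ∣ p ∣ ≡ suc ∣ p - x ∣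
  ∣p∣≡1+∣p-x∣ {p = inside ∷ p} here = cong (suc ∘ ∣_∣) (sym (p─⊥≡p p))
  ∣p∣≡1+∣p-x∣ {p = inside  ∷ p} (there x∈p) = cong suc (∣p∣≡1+∣p-x∣ x∈p)
  ∣p∣≡1+∣p-x∣ {p = outside ∷ p} (there x∈p) = ∣p∣≡1+∣p-x∣ x∈p

  ∣p-x∣≡ : ∀ {k n} {p : Subset k} {x} → x ∈ p → ∣ p ∣ ≡ suc n → ∣ p - x ∣ ≡ n
  ∣p-x∣≡ x∈p eq = ℕ.suc-injective (trans (sym (∣p∣≡1+∣p-x∣ x∈p)) eq)

  ∣p∣≡0⇒∉ : ∀ {k} {p : Subset k} {x} → ∣ p ∣ ≡ 0 → x ∉ p
  ∣p∣≡0⇒∉ eq x∈p with () ← trans (sym eq) (∣p∣≡1+∣p-x∣ x∈p)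

  ∣p∣≡suc⇒∃∈ : ∀ {k n} (p : Subset k) → ∣ p ∣ ≡ suc n → ∃ (_∈ p)
  ∣p∣≡suc⇒∃∈ (inside  ∷ p) _  = zero , here
  ∣p∣≡suc⇒∃∈ (outside ∷ p) eq with x , x∈p ← ∣p∣≡suc⇒∃∈ p eq = suc x , there x∈p

  ∣p∣≡1⇒unique : ∀ {k} {p : Subset k} {x y} → ∣ p ∣ ≡ 1 → x ∈ p → y ∈ p → x ≡ y
  ∣p∣≡1⇒unique {x = x} {y} eq x∈p y∈p with y ≟ x
  ... | yes y≡x = sym y≡x
  ... | no  y≢x = contradiction (∈-remove⁺ y∈p y≢x) (∣p∣≡0⇒∉ (∣p-x∣≡ x∈p eq))

  ∣tabulate∣-insert : ∀ {k} (g h : Fin k → Bool) x → g x ≡ true → h x ≡ false → (∀ i → i ≢ x → g i ≡ h i) →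
                      ∣ tabulate g ∣ ≡ suc ∣ tabulate h ∣
  ∣tabulate∣-insert {suc k} g h zero gx hx same rewrite gx | hx =
    cong (suc ∘ ∣_∣) (tabulate-cong λ i → same (suc i) λ ())
  ∣tabulate∣-insert {suc k} g h (suc x) gx hx same rewrite same zero (λ ()) with h zero
  ... | true  = cong suc (∣tabulate∣-insert (g ∘ suc) (h ∘ suc) x gx hx λ i i≢x → same (suc i) (i≢x ∘ suc-injective))
  ... | false = ∣tabulate∣-insert (g ∘ suc) (h ∘ suc) x gx hx λ i i≢x → same (suc i) (i≢x ∘ suc-injective)

  ∣tabulate∣≡0 : ∀ {k} (g : Fin k → Bool) → (∀ i → g i ≡ false) → ∣ tabulate g ∣ ≡ 0
  ∣tabulate∣≡0 {zero}  g _     = refl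
  ∣tabulate∣≡0 {suc k} g empty rewrite empty zero = ∣tabulate∣≡0 (g ∘ suc) (empty ∘ suc)

  record Distinct₃ {k} (p : Subset k) (a b c : Fin k) : Set where
    field
      a∈p : a ∈ p
      b∈p : b ∈ p
      c∈p : c ∈ p
      a≢b : a ≢ b
      b≢c : b ≢ c
      a≢c : a ≢ c

  module _ {k} {p : Subset k} (∣p∣≡3 : ∣ p ∣ ≡ 3) where

    ∣p∣≡3⇒exhaustive : ∀ {a b c} → Distinct₃ p a b c → ∀ {x} → x ∈ p → x ≡ a ⊎ x ≡ b ⊎ x ≡ c
    ∣p∣≡3⇒exhaustive {a} {b} {c} d {x} x∈p with x ≟ a | x ≟ b | x ≟ c
    ... | yes x≡a | _ | _ = inj₁ x≡a
    ... | no _ | yes x≡b | _ = inj₂ (inj₁ x≡b)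
    ... | no _ | no _ | yes x≡c = inj₂ (inj₂ x≡c)
    ... | no x≢a | no x≢b | no x≢c = contradiction (∈-remove⁺ (∈-remove⁺ (∈-remove⁺ x∈p x≢a) x≢b) x≢c) (∣p∣≡0⇒∉ size)
      where
      open Distinct₃ d
      size : ∣ p - a - b - c ∣ ≡ 0
      size = ∣p-x∣≡ (∈-remove⁺ (∈-remove⁺ c∈p (≢-sym a≢c)) (≢-sym b≢c))
               (∣p-x∣≡ (∈-remove⁺ b∈p (≢-sym a≢b)) (∣p-x∣≡ a∈p ∣p∣≡3))

    ∣p∣≡3⇒Distinct₃ : ∀ {a} → a ∈ p → ∃₂ λ b c → Distinct₃ p a b c
    ∣p∣≡3⇒Distinct₃ {a} a∈p with b , b∈p-a ← ∣p∣≡suc⇒∃∈ (p - a) (∣p-x∣≡ a∈p ∣p∣≡3)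
                            with c , c∈p-a-b ← ∣p∣≡suc⇒∃∈ (p - a - b) (∣p-x∣≡ b∈p-a (∣p-x∣≡ a∈p ∣p∣≡3)) =
      b , c , record
        { a∈p = a∈p ; b∈p = proj₁ b∈p×b≢a ; c∈p = proj₁ c∈p×c≢a
        ; a≢b = ≢-sym (proj₂ b∈p×b≢a) ; b≢c = ≢-sym (proj₂ c∈p-a×c≢b) ; a≢c = ≢-sym (proj₂ c∈p×c≢a) }
      where
      b∈p×b≢a : b ∈ p × b ≢ a
      b∈p×b≢a = ∈-remove⁻ b∈p-a
      c∈p-a×c≢b : c ∈ p - a × c ≢ b
      c∈p-a×c≢b = ∈-remove⁻ c∈p-a-b
      c∈p×c≢a : c ∈ p × c ≢ a
      c∈p×c≢a = ∈-remove⁻ (proj₁ c∈p-a×c≢b)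

    module _ {c ℓ} (M : CommutativeMonoid c ℓ) where
      open CommutativeMonoid M using (Carrier; _≈_; _∙_; ε; ∙-cong; identityʳ; setoid; monoid)
        renaming (refl to ≈-refl; sym to ≈-sym; trans to ≈-trans)
      open CommutativeMonoidSum M using (sum; sum-cong-≋; ∑-distrib-+)
      open import Relation.Binary.Reasoning.Setoid setoid

      sum-Distinct₃ : ∀ {a b c} → Distinct₃ p a b c → (g : Fin k → Carrier) →
                      sum (λ i → if lookup p i then g i else ε) ≈ g a ∙ (g b ∙ g c)
      sum-Distinct₃ {a} {b} {c} d g = begin
        sum (λ i → if lookup p i then g i else ε)
          ≈⟨ sum-cong-≋ split ⟩
        sum (λ i → picks a i ∙ (picks b i ∙ picks c i))
          ≈⟨ ∑-distrib-+ (λ i → picks a i) _ ⟩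
        sum (picks a) ∙ sum (λ i → picks b i ∙ picks c i)
          ≈⟨ ∙-cong (sum-δ monoid a g) (∑-distrib-+ (picks b) _) ⟩
        g a ∙ (sum (picks b) ∙ sum (picks c))
          ≈⟨ ∙-cong ≈-refl (∙-cong (sum-δ monoid b g) (sum-δ monoid c g)) ⟩
        g a ∙ (g b ∙ g c) ∎
        where
        open Distinct₃ d
        picks : Fin k → Fin k → Carrier
        picks j i = if δ i j then g i else ε
        ε∙ε≈ε : ε ∙ ε ≈ ε
        ε∙ε≈ε = identityʳ ε
        absent : ∀ {i j} → lookup p i ≡ false → j ∈ p → i ≢ j
        absent i∉p j∈p refl with () ← trans (sym i∉p) ([]=⇒lookup j∈p)
        split : ∀ i → (if lookup p i then g i else ε) ≈ picks a i ∙ (picks b i ∙ picks c i)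
        split i with lookup p i in i∈p
        ... | true with ∣p∣≡3⇒exhaustive d (lookup⇒[]= i p i∈p)
        ...   | inj₁ refl rewrite dec-true (i ≟ i) refl | dec-false (i ≟ b) a≢b | dec-false (i ≟ c) a≢c =
                ≈-sym (≈-trans (∙-cong ≈-refl ε∙ε≈ε) (identityʳ (g i)))
        ...   | inj₂ (inj₁ refl) rewrite dec-false (i ≟ a) (≢-sym a≢b) | dec-true (i ≟ i) refl | dec-false (i ≟ c) b≢c =
                ≈-sym (≈-trans (CommutativeMonoid.identityˡ M _) (identityʳ (g i)))
        ...   | inj₂ (inj₂ refl) rewrite dec-false (i ≟ a) (≢-sym a≢c) | dec-false (i ≟ b) (≢-sym b≢c) | dec-true (i ≟ i) refl =
                ≈-sym (≈-trans (CommutativeMonoid.identityˡ M _) (CommutativeMonoid.identityˡ M (g i)))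
        split i | false
          rewrite dec-false (i ≟ a) (absent i∈p a∈p) | dec-false (i ≟ b) (absent i∈p b∈p)
                | dec-false (i ≟ c) (absent i∈p c∈p) =
            ≈-sym (≈-trans (∙-cong ≈-refl ε∙ε≈ε) ε∙ε≈ε)

  bitsToFin : ∀ {k} → Subset k → Fin (2 ^ k)
  bitsToFin []      = zero
  bitsToFin (s ∷ S) = combine (Inverse.from 2↔Bool s) (bitsToFin S)

  finToBits : ∀ {k} → Fin (2 ^ k) → Subset k
  finToBits {zero}  _ = []
  finToBits {suc k} i with q , r ← remQuot {2} (2 ^ k) i = Inverse.to 2↔Bool q ∷ finToBits r

  finToBits∘bitsToFin : ∀ {k} (S : Subset k) → finToBits (bitsToFin S) ≡ S
  finToBits∘bitsToFin [] = refl
  finToBits∘bitsToFin {suc k} (s ∷ S) =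
    trans (cong (λ qr → Inverse.to 2↔Bool (proj₁ qr) ∷ finToBits (proj₂ qr))
                (remQuot-combine {_} {2 ^ k} (Inverse.from 2↔Bool s) (bitsToFin S)))
          (cong₂ _∷_ (Inverse.strictlyInverseˡ 2↔Bool s) (finToBits∘bitsToFin S))

  bitsToFin∘finToBits : ∀ {k} (i : Fin (2 ^ k)) → bitsToFin (finToBits {k} i) ≡ i
  bitsToFin∘finToBits {zero}  zero = refl
  bitsToFin∘finToBits {suc k} i =
    trans (cong₂ (combine {2} {2 ^ k}) (Inverse.strictlyInverseʳ 2↔Bool (proj₁ qr)) (bitsToFin∘finToBits {k} (proj₂ qr)))
          (combine-remQuot {n = 2} (2 ^ k) i)
    where
    qr : Fin 2 × Fin (2 ^ k)
    qr = remQuot {2} (2 ^ k) i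

  evenToFin : ∀ {k} → Subset k → Fin (2 ^ pred k)
  evenToFin []      = zero
  evenToFin (_ ∷ S) = bitsToFin S

  finToEven : ∀ {k} → Fin (2 ^ pred k) → Subset k
  finToEven {zero}  _ = []
  finToEven {suc k} i = parity (lookup S) ∷ S
    where S = finToBits i

  finToEven-even : ∀ {k} (i : Fin (2 ^ pred k)) → parity (lookup (finToEven {k} i)) ≡ false
  finToEven-even {zero}  _ = refl
  finToEven-even {suc k} i = xor-same (parity (lookup (finToBits {k} i)))

  evenToFin∘finToEven : ∀ {k} (i : Fin (2 ^ pred k)) → evenToFin (finToEven {k} i) ≡ i
  evenToFin∘finToEven {zero}  zero = refl
  evenToFin∘finToEven {suc k} i = bitsToFin∘finToBits {k} i

  finToEven∘evenToFin : ∀ {k} (S : Subset k) → parity (lookup S) ≡ false → finToEven (evenToFin S) ≡ S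
  finToEven∘evenToFin []      _    = refl
  finToEven∘evenToFin (s ∷ S) even rewrite finToBits∘bitsToFin S = cong (_∷ S) (sym (xor≡false⇒≡ even))

  restrict : ∀ {k} (P : Subset k) → Subset k → Subset ∣ P ∣
  restrict []            []      = []
  restrict (inside  ∷ P) (s ∷ S) = s ∷ restrict P S
  restrict (outside ∷ P) (_ ∷ S) = restrict P S

  expand : ∀ {k} (P : Subset k) → Subset ∣ P ∣ → Subset k
  expand []            []      = []
  expand (inside  ∷ P) (s ∷ T) = s ∷ expand P T
  expand (outside ∷ P) T       = outside ∷ expand P T

  restrict∘expand : ∀ {k} (P : Subset k) T → restrict P (expand P T) ≡ T
  restrict∘expand []            []      = refl
  restrict∘expand (inside  ∷ P) (s ∷ T) = cong (s ∷_) (restrict∘expand P T)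
  restrict∘expand (outside ∷ P) T       = restrict∘expand P T

  expand∘restrict : ∀ {k} (P S : Subset k) → S ⊆ P → expand P (restrict P S) ≡ S
  expand∘restrict []            []            _   = refl
  expand∘restrict (inside  ∷ P) (s ∷ S)       S⊆P = cong (s ∷_) (expand∘restrict P S (drop-there ∘ S⊆P ∘ there))
  expand∘restrict (outside ∷ P) (outside ∷ S) S⊆P = cong (outside ∷_) (expand∘restrict P S (drop-there ∘ S⊆P ∘ there))
  expand∘restrict (outside ∷ P) (inside  ∷ S) S⊆P with () ← S⊆P here

  expand⊆ : ∀ {k} (P : Subset k) T → expand P T ⊆ P
  expand⊆ (inside  ∷ P) (s ∷ T) here          = here
  expand⊆ (inside  ∷ P) (s ∷ T) (there x∈)    = there (expand⊆ P T x∈)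
  expand⊆ (outside ∷ P) T       (there x∈)    = there (expand⊆ P T x∈)

  parity-expand : ∀ {k} (P : Subset k) T → parity (lookup (expand P T)) ≡ parity (lookup T)
  parity-expand []            []      = refl
  parity-expand (inside  ∷ P) (s ∷ T) = cong (s xor_) (parity-expand P T)
  parity-expand (outside ∷ P) T       = parity-expand P T

  EvenSubsetOf : ∀ {k} → (Fin k → Set) → Set
  EvenSubsetOf {k} Q = Σ (Subset k) λ S → (∀ v → v ∈ S → Q v) × 2 ∣ ∣ S ∣

  module _ {k} {Q : Fin k → Set} (Q? : Decidable Q) where

    private
      P : Subset k
      P = tabulate (does ∘ Q?)

      ∈P⇒Q : ∀ {v} → v ∈ P → Q v
      ∈P⇒Q {v} v∈P with Q? v | trans (sym (lookup∘tabulate (does ∘ Q?) v)) ([]=⇒lookup v∈P)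
      ... | yes q | _ = q

      Q⇒∈P : ∀ {v} → Q v → v ∈ P
      Q⇒∈P {v} q = lookup⇒[]= v P (trans (lookup∘tabulate (does ∘ Q?) v) (dec-true (Q? v) q))

    evenSubsetOf↔Fin : Bij (EvenSubsetOf Q) (Fin (2 ^ pred ∣ P ∣)) proj₁ id
    evenSubsetOf↔Fin = record
      { to      = λ (S , _) → evenToFin (restrict P S)
      ; from    = λ i → expand P (T i) , (λ v → ∈P⇒Q ∘ expand⊆ P (T i))
                      , Equivalence.from (even⇔parity≡false (expand P (T i)))
                          (trans (parity-expand P (T i)) (finToEven-even {∣ P ∣} i))
      ; from-to = from-to
      ; to-from = λ i → trans (cong evenToFin (restrict∘expand P (T i))) (evenToFin∘finToEven {∣ P ∣} i)
      }
      where
      T : Fin (2 ^ pred ∣ P ∣) → Subset ∣ P ∣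
      T = finToEven
      from-to : ∀ ((S , _) : EvenSubsetOf Q) → expand P (finToEven (evenToFin (restrict P S))) ≡ S
      from-to (S , S⊆Q , even) =
        trans (cong (expand P) (finToEven∘evenToFin (restrict P S) restrict-even)) S-restored
        where
        S-restored : expand P (restrict P S) ≡ S
        S-restored = expand∘restrict P S (Q⇒∈P ∘ S⊆Q _)
        restrict-even : parity (lookup (restrict P S)) ≡ false
        restrict-even = trans (sym (parity-expand P (restrict P S)))
          (trans (cong (parity ∘ lookup) S-restored) (Equivalence.to (even⇔parity≡false S) even))

  Bij-∘ : ∀ {A B C P Q R : Set} {πA : A → P} {πB : B → Q} {πC : C → R}
          (f : Bij A B πA πB) (g : Bij B C πB πC) →
          (∀ {b b′} → πB b ≡ πB b′ → πA (Bij.from f b) ≡ πA (Bij.from f b′)) →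
          (∀ {b b′} → πB b ≡ πB b′ → πC (Bij.to g b) ≡ πC (Bij.to g b′)) →
          Bij A C πA πC
  Bij-∘ f g from-resp to-resp = record
    { to      = Bij.to g ∘ Bij.to f
    ; from    = Bij.from f ∘ Bij.from g
    ; from-to = λ a → trans (from-resp (Bij.from-to g (Bij.to f a))) (Bij.from-to f a)
    ; to-from = λ c → trans (to-resp (Bij.to-from f (Bij.from g c))) (Bij.to-from g c)
    }

  suc≡-by-punctured-bijection : ∀ {M N} (r : Fin N) (f : Fin M → Fin N) →
    (∀ e → f e ≢ r) → (∀ {e e′} → f e ≡ f e′ → e ≡ e′) → (∀ x → x ≢ r → ∃ λ e → f e ≡ x) → suc M ≡ N
  suc≡-by-punctured-bijection {M} {suc N} r f f≢r f-injective f-onto =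
    cong suc (ℕ.≤-antisym (injective⇒≤ punchOut∘f-injective) (injective⇒≤ preimage∘punchIn-injective))
    where
    punchOut∘f : Fin M → Fin N
    punchOut∘f e = punchOut (≢-sym (f≢r e))
    punchOut∘f-injective : ∀ {e e′} → punchOut∘f e ≡ punchOut∘f e′ → e ≡ e′
    punchOut∘f-injective {e} {e′} eq = f-injective
      (trans (sym (punchIn-punchOut (≢-sym (f≢r e)))) (trans (cong (punchIn r) eq) (punchIn-punchOut (≢-sym (f≢r e′)))))
    preimage∘punchIn : Fin N → Fin M
    preimage∘punchIn i = proj₁ (f-onto (punchIn r i) (punchInᵢ≢i r i))
    preimage∘punchIn-injective : ∀ {i j} → preimage∘punchIn i ≡ preimage∘punchIn j → i ≡ j
    preimage∘punchIn-injective {i} {j} eq = punchIn-injective r i j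
      (trans (sym (proj₂ (f-onto (punchIn r i) (punchInᵢ≢i r i))))
        (trans (cong f eq) (proj₂ (f-onto (punchIn r j) (punchInᵢ≢i r j)))))

open Combinatorics

module Trees where

  open import Data.List.Base using ([]; _∷_; length)
  open import Data.List.Membership.Propositional using () renaming (_∈_ to _∈ₗ_)
  import Data.List.Membership.DecPropositional as MembershipDec
  open import Data.List.Relation.Unary.All.Properties.Core using (¬Any⇒All¬)
  open import Data.List.Relation.Unary.AllPairs using ([]; _∷_)
  open import Data.List.Relation.Unary.Any using (here; there)
  open import Data.List.Relation.Unary.Unique.Propositional using (Unique)
  import Data.List.Relation.Unary.Unique.DecPropositional as UniqueDec
  open import Data.Nat.Base using (_+_; _*_; _≤_; _<_; s≤s)

  module Walks (G : Graph) where
    open Graph G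
    open MembershipDec (_≟_ {m}) using () renaming (_∈?_ to _∈ₗ?_)

    χ : ∀ {u v} → Walk G u v → Fin m → Bool
    χ nil       e = false
    χ (fwd f p) e = δ e f xor χ p e
    χ (bwd f p) e = δ e f xor χ p e

    len : ∀ {u v} → Walk G u v → ℕ
    len p = length (walkEdges G p)

    infixr 5 _++_ _◅_

    _++_ : ∀ {u v w} → Walk G u v → Walk G v w → Walk G u w
    nil     ++ q = q
    fwd f p ++ q = fwd f (p ++ q)
    bwd f p ++ q = bwd f (p ++ q)

    reverse : ∀ {u v} → Walk G u v → Walk G v u
    reverse nil       = nil
    reverse (fwd f p) = reverse p ++ bwd f nil
    reverse (bwd f p) = reverse p ++ fwd f nil

    χ-++ : ∀ {u v w} (p : Walk G u v) (q : Walk G v w) e → χ (p ++ q) e ≡ χ p e xor χ q e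
    χ-++ nil       q e = refl
    χ-++ (fwd f p) q e = trans (cong (δ e f xor_) (χ-++ p q e)) (sym (xor-assoc (δ e f) _ _))
    χ-++ (bwd f p) q e = trans (cong (δ e f xor_) (χ-++ p q e)) (sym (xor-assoc (δ e f) _ _))

    len-++ : ∀ {u v w} (p : Walk G u v) (q : Walk G v w) → len (p ++ q) ≡ len p + len q
    len-++ nil       q = refl
    len-++ (fwd f p) q = cong suc (len-++ p q)
    len-++ (bwd f p) q = cong suc (len-++ p q)

    χ-reverse : ∀ {u v} (p : Walk G u v) e → χ (reverse p) e ≡ χ p e
    χ-reverse nil       e = refl
    χ-reverse (fwd f p) e = trans (χ-++ (reverse p) (bwd f nil) e)
      (trans (cong₂ _xor_ (χ-reverse p e) (xor-identityʳ (δ e f))) (xor-comm (χ p e) (δ e f)))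
    χ-reverse (bwd f p) e = trans (χ-++ (reverse p) (fwd f nil) e)
      (trans (cong₂ _xor_ (χ-reverse p e) (xor-identityʳ (δ e f))) (xor-comm (χ p e) (δ e f)))

    data Step (f : Fin m) : Fin n → Fin n → Set where
      forward  : Step f (src f) (tgt f)
      backward : Step f (tgt f) (src f)

    _◅_ : ∀ {f x y w} → Step f x y → Walk G y w → Walk G x w
    forward  ◅ p = fwd _ p
    backward ◅ p = bwd _ p

    ◅-++ : ∀ {f x y v w} (s : Step f x y) (p : Walk G y v) (q : Walk G v w) → (s ◅ p) ++ q ≡ s ◅ (p ++ q)
    ◅-++ forward  p q = refl
    ◅-++ backward p q = refl

    χ-◅ : ∀ {f x y w} (s : Step f x y) (p : Walk G y w) e → χ (s ◅ p) e ≡ δ e f xor χ p e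
    χ-◅ forward  p e = refl
    χ-◅ backward p e = refl

    len-◅ : ∀ {f x y w} (s : Step f x y) (p : Walk G y w) → len (s ◅ p) ≡ suc (len p)
    len-◅ forward  p = refl
    len-◅ backward p = refl

    record Occurrence {u v} (f : Fin m) (p : Walk G u v) : Set where
      constructor occurrence
      field
        {x y}  : Fin n
        before : Walk G u x
        step   : Step f x y
        after  : Walk G y v
        split  : p ≡ before ++ step ◅ after

    occurs : ∀ {u v f} (p : Walk G u v) → f ∈ₗ walkEdges G p → Occurrence f p
    occurs (fwd f p) (here refl) = occurrence nil forward p refl
    occurs (bwd f p) (here refl) = occurrence nil backward p refl
    occurs (fwd g p) (there f∈p) with occurrence A s C eq ← occurs p f∈p = occurrence (fwd g A) s C (cong (fwd g) eq)
    occurs (bwd g p) (there f∈p) with occurrence A s C eq ← occurs p f∈p = occurrence (bwd g A) s C (cong (bwd g) eq)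

    record Repetition {u v} (p : Walk G u v) : Set where
      constructor repetition
      field
        {f}         : Fin m
        {x₁ y₁ x₂ y₂} : Fin n
        A  : Walk G u x₁
        s₁ : Step f x₁ y₁
        B  : Walk G y₁ x₂
        s₂ : Step f x₂ y₂
        C  : Walk G y₂ v
        split : p ≡ A ++ s₁ ◅ B ++ s₂ ◅ C

    repeats : ∀ {u v} (p : Walk G u v) → ¬ Unique (walkEdges G p) → Repetition p
    repeats-◅ : ∀ {f x y v} (s : Step f x y) (p : Walk G y v) → ¬ Unique (f ∷ walkEdges G p) → Repetition (s ◅ p)

    repeats nil       ¬u = contradiction [] ¬u
    repeats (fwd f p) = repeats-◅ forward p
    repeats (bwd f p) = repeats-◅ backward p

    repeats-◅ {f} s p ¬u with f ∈ₗ? walkEdges G p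
    ... | yes f∈p with occurrence B s₂ C eq ← occurs p f∈p = repetition nil s B s₂ C (cong (s ◅_) eq)
    ... | no  f∉p with repetition A s₁ B s₂ C eq ← repeats p (¬u ∘ (¬Any⇒All¬ _ f∉p ∷_)) =
      repetition (s ◅ A) s₁ B s₂ C (trans (cong (s ◅_) eq) (sym (◅-++ s A _)))

    inc : Fin n → Fin m → Bool
    inc v e = lookup (incident G v) e

    inc≡ : ∀ v e → inc v e ≡ δ (src e) v ∨ δ (tgt e) v
    inc≡ v e = trans (lookup∘tabulate _ e) (trans (if-true-false _) (cong₂ _∨_ (isYes≗does (src e ≟ v)) (isYes≗does (tgt e ≟ v))))
      where
      if-true-false : ∀ b → (if b then true else false) ≡ b
      if-true-false true  = refl
      if-true-false false = refl

    inc⇒tgt : ∀ {z f} → inc z f ≡ true → δ (src f) z ≡ false → tgt f ≡ z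
    inc⇒tgt {z} {f} z∈f src≢z = δ≡true⇒≡ (trans (sym (cong (_∨ δ (tgt f) z) src≢z)) (trans (sym (inc≡ z f)) z∈f))

    src-inc : ∀ e → inc (src e) e ≡ true
    src-inc e = trans (inc≡ (src e) e) (cong (_∨ δ (tgt e) (src e)) (dec-true (src e ≟ src e) refl))

    tgt-inc : ∀ e → inc (tgt e) e ≡ true
    tgt-inc e = trans (inc≡ (tgt e) e) (trans (cong (δ (src e) (tgt e) ∨_) (dec-true (tgt e ≟ tgt e) refl)) (∨-zeroʳ _))

    ∂ : (Fin m → Bool) → Fin n → Bool
    ∂ D v = parity (λ e → inc v e ∧ D e)

    ∂-xor : ∀ D D′ v → ∂ (λ e → D e xor D′ e) v ≡ ∂ D v xor ∂ D′ v
    ∂-xor D D′ v = trans (⊕.sum-cong-≗ λ e → ∧-distribˡ-xor (inc v e) (D e) (D′ e))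
                         (⊕.∑-distrib-+ (λ e → inc v e ∧ D e) (λ e → inc v e ∧ D′ e))

    ∂-δ : ∀ f v → ∂ (λ e → δ e f) v ≡ inc v f
    ∂-δ f v = trans (⊕.sum-cong-≗ λ e → ∧-comm (inc v e) (δ e f)) (parity-δ f (inc v))

  module Forest (G : Graph) (acyclic : Acyclic G) where
    open Graph G
    open Walks G
    open UniqueDec (_≟_ {m}) using (unique?)
    open Data.Bool.Solver.xor-∧-Solver using (solve; _:=_; _:+_)

    private
      χ-repetition : ∀ {v x₁ y₁ x₂ y₂ f} (A : Walk G v x₁) (s₁ : Step f x₁ y₁) (B : Walk G y₁ x₂) (s₂ : Step f x₂ y₂)
                     (C : Walk G y₂ v) e → χ (A ++ s₁ ◅ B ++ s₂ ◅ C) e ≡ χ A e xor (χ B e xor χ C e)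
      χ-repetition {f = f} A s₁ B s₂ C e =
        trans (χ-++ A _ e) (cong (χ A e xor_) (trans (χ-◅ s₁ _ e) (trans (cong (δ e f xor_) (trans (χ-++ B _ e)
          (cong (χ B e xor_) (χ-◅ s₂ C e)))) (cancel (δ e f) (χ B e) (χ C e)))))
        where
        cancel : ∀ d b c → d xor (b xor (d xor c)) ≡ b xor c
        cancel = solve 3 (λ d b c → d :+ (b :+ (d :+ c)) := b :+ c) refl

      len-repetition : ∀ {v x₁ y₁ x₂ y₂ f} (A : Walk G v x₁) (s₁ : Step f x₁ y₁) (B : Walk G y₁ x₂) (s₂ : Step f x₂ y₂)
                       (C : Walk G y₂ v) → len (A ++ s₁ ◅ B ++ s₂ ◅ C) ≡ len A + suc (len B + suc (len C))
      len-repetition A s₁ B s₂ C =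
        trans (len-++ A _) (cong (len A +_) (trans (len-◅ s₁ _) (cong suc (trans (len-++ B _) (cong (len B +_) (len-◅ s₂ C))))))

      outer-shorter : ∀ a b c → a + suc c < a + suc (b + suc c)
      outer-shorter a b c = subst (suc (a + suc c) ≤_) (sym (ℕ.+-suc a (b + suc c))) (s≤s (ℕ.+-monoʳ-≤ a (ℕ.m≤n+m (suc c) b)))

      inner-shorter : ∀ a b c → suc b < a + suc (b + suc c)
      inner-shorter a b c = ℕ.≤-trans (s≤s (subst (suc b ≤_) (sym (ℕ.+-suc b c)) (s≤s (ℕ.m≤m+n b c)))) (ℕ.m≤n+m _ a)

      module _ {k} (shorter-even : ∀ {v} (p : Walk G v v) → len p < k → ∀ e → χ p e ≡ false) where

        same-direction : ∀ {v x y f} (A : Walk G v x) (s₁ s₂ : Step f x y) (B : Walk G y x) (C : Walk G y v) →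
                         len (A ++ s₁ ◅ B ++ s₂ ◅ C) ≤ k → ∀ e → χ (A ++ s₁ ◅ B ++ s₂ ◅ C) e ≡ false
        same-direction {f = f} A s₁ s₂ B C ≤k e =
          trans (χ-repetition A s₁ B s₂ C e) (trans (regroup (χ A e) (χ B e) (χ C e) (δ e f)) (cong₂ _xor_ outer inner))
          where
          total≤k : len A + suc (len B + suc (len C)) ≤ k
          total≤k = subst (_≤ k) (len-repetition A s₁ B s₂ C) ≤k
          regroup : ∀ a b c d → a xor (b xor c) ≡ (a xor (d xor c)) xor (d xor b)
          regroup = solve 4 (λ a b c d → a :+ (b :+ c) := (a :+ (d :+ c)) :+ (d :+ b)) refl
          outer : χ A e xor (δ e f xor χ C e) ≡ false
          outer = trans (sym (trans (χ-++ A _ e) (cong (χ A e xor_) (χ-◅ s₁ C e))))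
            (shorter-even (A ++ s₁ ◅ C) (ℕ.<-≤-trans (subst (_< _) (sym (trans (len-++ A _) (cong (len A +_) (len-◅ s₁ C))))
              (outer-shorter (len A) (len B) (len C))) total≤k) e)
          inner : δ e f xor χ B e ≡ false
          inner = trans (sym (χ-◅ s₂ B e))
            (shorter-even (s₂ ◅ B) (ℕ.<-≤-trans (subst (_< _) (sym (len-◅ s₂ B)) (inner-shorter (len A) (len B) (len C))) total≤k) e)

        opposite-direction : ∀ {v x y f} (A : Walk G v x) (s₁ : Step f x y) (B : Walk G y y) (s₂ : Step f y x) (C : Walk G x v) →
                             len (A ++ s₁ ◅ B ++ s₂ ◅ C) ≤ k → ∀ e → χ (A ++ s₁ ◅ B ++ s₂ ◅ C) e ≡ false
        opposite-direction A s₁ B s₂ C ≤k e =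
          trans (χ-repetition A s₁ B s₂ C e) (trans (regroup (χ A e) (χ B e) (χ C e)) (cong₂ _xor_ outer inner))
          where
          total≤k : len A + suc (len B + suc (len C)) ≤ k
          total≤k = subst (_≤ k) (len-repetition A s₁ B s₂ C) ≤k
          regroup : ∀ a b c → a xor (b xor c) ≡ (a xor c) xor b
          regroup = solve 3 (λ a b c → a :+ (b :+ c) := (a :+ c) :+ b) refl
          outer : χ A e xor χ C e ≡ false
          outer = trans (sym (χ-++ A C e))
            (shorter-even (A ++ C) (ℕ.<-≤-trans (subst (_< len A + suc (len B + suc (len C))) (sym (len-++ A C))
              (ℕ.≤-<-trans (ℕ.+-monoʳ-≤ (len A) (ℕ.n≤1+n (len C))) (outer-shorter (len A) (len B) (len C)))) total≤k) e)
          inner : χ B e ≡ false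
          inner = shorter-even B (ℕ.<-≤-trans (ℕ.<-trans (ℕ.n<1+n (len B)) (inner-shorter (len A) (len B) (len C))) total≤k) e

    -- A closed walk with a repeated edge f splits at the two traversals of f into two shorter
    -- closed walks: A s₁ C and s₂ B if f is traversed twice in the same direction, A C and B otherwise.
    χ-closed-bounded : ∀ k {v} (p : Walk G v v) → len p < k → ∀ e → χ p e ≡ false
    χ-closed-bounded (suc k) p (s≤s len≤k) e with unique? (walkEdges G p)
    ... | yes unique = χ-trivial p (acyclic _ p unique)
      where
      χ-trivial : ∀ {v} (p : Walk G v v) → len p ≡ 0 → χ p e ≡ false
      χ-trivial nil _ = refl
    ... | no ¬unique with repeats p ¬unique
    ... | repetition A forward  B forward  C refl = same-direction (χ-closed-bounded k) A forward forward B C len≤k e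
    ... | repetition A backward B backward C refl = same-direction (χ-closed-bounded k) A backward backward B C len≤k e
    ... | repetition A forward  B backward C refl = opposite-direction (χ-closed-bounded k) A forward B backward C len≤k e
    ... | repetition A backward B forward  C refl = opposite-direction (χ-closed-bounded k) A backward B forward C len≤k e

    χ-closed : ∀ {u v} (p : Walk G u v) → u ≡ v → ∀ e → χ p e ≡ false
    χ-closed p refl = χ-closed-bounded (suc (len p)) p ℕ.≤-refl

    no-loop : ∀ f → src f ≢ tgt f
    no-loop f loop with () ← trans (sym (cong (_xor false) (dec-true (f ≟ f) refl))) (χ-closed (fwd f nil) loop f)

    not-both-ends : ∀ e v → δ (src e) v ≡ true → δ (tgt e) v ≡ true → ⊥
    not-both-ends e v src≡v tgt≡v = no-loop e (trans (δ≡true⇒≡ src≡v) (sym (δ≡true⇒≡ tgt≡v)))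

    inc-xor : ∀ v e → inc v e ≡ δ (src e) v xor δ (tgt e) v
    inc-xor v e = trans (inc≡ v e) (∨≡xor (δ (src e) v) (δ (tgt e) v) (not-both-ends e v))
      where
      ∨≡xor : ∀ a b → (a ≡ true → b ≡ true → ⊥) → a ∨ b ≡ a xor b
      ∨≡xor true  true  both = ⊥-elim (both refl refl)
      ∨≡xor true  false _    = refl
      ∨≡xor false b     _    = refl

    coboundary : ∀ (g : Fin n → Bool) f → parity (λ v → inc v f ∧ g v) ≡ g (src f) xor g (tgt f)
    coboundary g f = begin
      parity (λ v → inc v f ∧ g v)
        ≡⟨ ⊕.sum-cong-≗ split ⟩
      parity (λ v → (δ v (src f) ∧ g v) xor (δ v (tgt f) ∧ g v))
        ≡⟨ ⊕.∑-distrib-+ (λ v → δ v (src f) ∧ g v) _ ⟩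
      parity (λ v → δ v (src f) ∧ g v) xor parity (λ v → δ v (tgt f) ∧ g v)
        ≡⟨ cong₂ _xor_ (parity-δ (src f) g) (parity-δ (tgt f) g) ⟩
      g (src f) xor g (tgt f) ∎
      where
      open ≡-Reasoning
      split : ∀ v → inc v f ∧ g v ≡ (δ v (src f) ∧ g v) xor (δ v (tgt f) ∧ g v)
      split v rewrite inc-xor v f | δ-sym (src f) v | δ-sym (tgt f) v = ∧-distribʳ-xor (g v) (δ v (src f)) (δ v (tgt f))

    ∂-χ : ∀ {u w} (p : Walk G u w) v → ∂ (χ p) v ≡ δ u v xor δ w v
    ∂-χ {u} nil v = trans (⊕.sum-cong-≗ λ e → ∧-zeroʳ (inc v e)) (trans (⊕.sum-replicate-zero m) (sym (xor-same (δ u v))))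
    ∂-χ {w = w} (fwd f p) v = trans (∂-xor _ (χ p) v)
      (trans (cong₂ _xor_ (trans (∂-δ f v) (inc-xor v f)) (∂-χ p v)) (telescope (δ (src f) v) (δ (tgt f) v) (δ w v)))
      where
      telescope : ∀ a b c → (a xor b) xor (b xor c) ≡ a xor c
      telescope = solve 3 (λ a b c → (a :+ b) :+ (b :+ c) := a :+ c) refl
    ∂-χ {w = w} (bwd f p) v = trans (∂-xor _ (χ p) v)
      (trans (cong₂ _xor_ (trans (∂-δ f v) (inc-xor v f)) (∂-χ p v)) (telescope (δ (tgt f) v) (δ (src f) v) (δ w v)))
      where
      telescope : ∀ a b c → (b xor a) xor (b xor c) ≡ a xor c
      telescope = solve 3 (λ a b c → (b :+ a) :+ (b :+ c) := a :+ c) refl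

    ∂-even : ∀ D → parity (∂ D) ≡ false
    ∂-even D = trans (⊕.∑-comm (λ v e → inc v e ∧ D e))
      (trans (⊕.sum-cong-≗ λ e → trans (coboundary (λ _ → D e) e) (xor-same (D e))) (⊕.sum-replicate-zero m))

    degree-sum : ℕΣ.sum (degree G) ≡ m * 2
    degree-sum = begin
      ℕΣ.sum (λ v → ∣ incident G v ∣)
        ≡⟨ ℕΣ.sum-cong-≗ (λ v → ∣S∣≡sum (incident G v)) ⟩
      ℕΣ.sum (λ v → ℕΣ.sum (λ e → 𝟙 (inc v e)))
        ≡⟨ ℕΣ.∑-comm (λ v e → 𝟙 (inc v e)) ⟩
      ℕΣ.sum (λ e → ℕΣ.sum (λ v → 𝟙 (inc v e)))
        ≡⟨ ℕΣ.sum-cong-≗ (λ e → endpoints e) ⟩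
      ℕΣ.sum {m} (λ _ → 2)
        ≡⟨ sum-const {m} 2 ⟩
      m * 2 ∎
      where
      open ≡-Reasoning
      𝟙 : Bool → ℕ
      𝟙 b = if b then 1 else 0
      𝟙-xor : ∀ a b → (a ≡ true → b ≡ true → ⊥) → 𝟙 (a xor b) ≡ 𝟙 a + 𝟙 b
      𝟙-xor true  true  both = ⊥-elim (both refl refl)
      𝟙-xor true  false _    = refl
      𝟙-xor false b     _    = refl
      endpoint : ∀ x → ℕΣ.sum (λ v → 𝟙 (δ x v)) ≡ 1
      endpoint x = trans (ℕΣ.sum-cong-≗ λ v → cong 𝟙 (δ-sym x v)) (sum-δ ℕ.+-0-monoid x (λ _ → 1))
      endpoints : ∀ e → ℕΣ.sum (λ v → 𝟙 (inc v e)) ≡ 2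
      endpoints e = begin
        ℕΣ.sum (λ v → 𝟙 (inc v e))
          ≡⟨ ℕΣ.sum-cong-≗ (λ v → trans (cong 𝟙 (inc-xor v e)) (𝟙-xor _ _ (not-both-ends e v))) ⟩
        ℕΣ.sum (λ v → 𝟙 (δ (src e) v) + 𝟙 (δ (tgt e) v))
          ≡⟨ ℕΣ.∑-distrib-+ (λ v → 𝟙 (δ (src e) v)) _ ⟩
        ℕΣ.sum (λ v → 𝟙 (δ (src e) v)) + ℕΣ.sum (λ v → 𝟙 (δ (tgt e) v))
          ≡⟨ cong₂ _+_ (endpoint (src e)) (endpoint (tgt e)) ⟩
        2 ∎

  module Rooted (G : Graph) (acyclic : Acyclic G) (connected : Connected G) (r : Fin (Graph.n G)) where
    open Graph G
    open Walks G
    open Forest G acyclic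
    open Data.Bool.Solver.xor-∧-Solver using (solve; _:=_; _:+_; _:*_)
    open ≡-Reasoning

    -- whether e lies on the path from the root to x; by χ≡cut any walk from r to x computes it
    cut : Fin m → Fin n → Bool
    cut e x = χ (connected r x) e

    χ≡cut : ∀ {x} (p : Walk G r x) e → χ p e ≡ cut e x
    χ≡cut {x} p e = xor≡false⇒≡ (begin
      χ p e xor cut e x                          ≡⟨ cong (χ p e xor_) (sym (χ-reverse (connected r x) e)) ⟩
      χ p e xor χ (reverse (connected r x)) e    ≡⟨ sym (χ-++ p _ e) ⟩
      χ (p ++ reverse (connected r x)) e         ≡⟨ χ-closed (p ++ reverse (connected r x)) refl e ⟩
      false                                      ∎)

    cut-root : ∀ e → cut e r ≡ false
    cut-root = χ-closed (connected r r) refl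

    cut-step : ∀ e f → cut e (tgt f) ≡ cut e (src f) xor δ e f
    cut-step e f = begin
      cut e (tgt f)                                ≡⟨ sym (χ≡cut (connected r (src f) ++ fwd f nil) e) ⟩
      χ (connected r (src f) ++ fwd f nil) e       ≡⟨ χ-++ (connected r (src f)) _ e ⟩
      cut e (src f) xor (δ e f xor false)          ≡⟨ cong (cut e (src f) xor_) (xor-identityʳ (δ e f)) ⟩
      cut e (src f) xor δ e f                      ∎

    join : (Fin n → Bool) → Fin m → Bool
    join S e = parity (λ v → cut e v ∧ S v)

    join-∂ : ∀ D e → join (∂ D) e ≡ D e
    join-∂ D e = begin
      parity (λ v → cut e v ∧ ∂ D v)
        ≡⟨ ⊕.sum-cong-≗ (λ v → ⊕.*-distribˡ-sum (cut e v) (λ f → inc v f ∧ D f)) ⟩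
      parity (λ v → parity (λ f → cut e v ∧ (inc v f ∧ D f)))
        ≡⟨ ⊕.∑-comm (λ v f → cut e v ∧ (inc v f ∧ D f)) ⟩
      parity (λ f → parity (λ v → cut e v ∧ (inc v f ∧ D f)))
        ≡⟨ ⊕.sum-cong-≗ (λ f → ⊕.sum-cong-≗ λ v → rearrange (cut e v) (inc v f) (D f)) ⟩
      parity (λ f → parity (λ v → inc v f ∧ (cut e v ∧ D f)))
        ≡⟨ ⊕.sum-cong-≗ (λ f → coboundary (λ v → cut e v ∧ D f) f) ⟩
      parity (λ f → (cut e (src f) ∧ D f) xor (cut e (tgt f) ∧ D f))
        ≡⟨ ⊕.sum-cong-≗ (λ f → crossing f) ⟩
      parity (λ f → δ f e ∧ D f)
        ≡⟨ parity-δ e D ⟩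
      D e ∎
      where
      rearrange : ∀ c i d → c ∧ (i ∧ d) ≡ i ∧ (c ∧ d)
      rearrange = solve 3 (λ c i d → c :* (i :* d) := i :* (c :* d)) refl
      crossing : ∀ f → (cut e (src f) ∧ D f) xor (cut e (tgt f) ∧ D f) ≡ δ f e ∧ D f
      crossing f rewrite cut-step e f | δ-sym f e = cancel (cut e (src f)) (δ e f) (D f)
        where
        cancel : ∀ c d x → (c ∧ x) xor ((c xor d) ∧ x) ≡ d ∧ x
        cancel = solve 3 (λ c d x → (c :* x) :+ ((c :+ d) :* x) := d :* x) refl

    ∂-join : ∀ S → parity S ≡ false → ∀ x → ∂ (join S) x ≡ S x
    ∂-join S even x = begin
      ∂ (join S) x
        ≡⟨ ⊕.sum-cong-≗ (λ e → ⊕.*-distribˡ-sum (inc x e) (λ v → cut e v ∧ S v)) ⟩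
      parity (λ e → parity (λ v → inc x e ∧ (cut e v ∧ S v)))
        ≡⟨ ⊕.∑-comm (λ e v → inc x e ∧ (cut e v ∧ S v)) ⟩
      parity (λ v → parity (λ e → inc x e ∧ (cut e v ∧ S v)))
        ≡⟨ ⊕.sum-cong-≗ (λ v → ⊕.sum-cong-≗ λ e → rearrange (inc x e) (cut e v) (S v)) ⟩
      parity (λ v → parity (λ e → S v ∧ (inc x e ∧ cut e v)))
        ≡⟨ ⊕.sum-cong-≗ (λ v → sym (⊕.*-distribˡ-sum (S v) (λ e → inc x e ∧ cut e v))) ⟩
      parity (λ v → S v ∧ ∂ (χ (connected r v)) x)
        ≡⟨ ⊕.sum-cong-≗ (λ v → cong (S v ∧_) (∂-χ (connected r v) x)) ⟩
      parity (λ v → S v ∧ (δ r x xor δ v x))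
        ≡⟨ ⊕.sum-cong-≗ (λ v → ∧-distribˡ-xor (S v) (δ r x) (δ v x)) ⟩
      parity (λ v → (S v ∧ δ r x) xor (S v ∧ δ v x))
        ≡⟨ ⊕.∑-distrib-+ (λ v → S v ∧ δ r x) _ ⟩
      parity (λ v → S v ∧ δ r x) xor parity (λ v → S v ∧ δ v x)
        ≡⟨ cong₂ _xor_ (sym (⊕.*-distribʳ-sum (δ r x) S)) (⊕.sum-cong-≗ λ v → ∧-comm (S v) (δ v x)) ⟩
      (parity S ∧ δ r x) xor parity (λ v → δ v x ∧ S v)
        ≡⟨ cong₂ _xor_ (cong (_∧ δ r x) even) (parity-δ x S) ⟩
      S x ∎
      where
      rearrange : ∀ i c s → i ∧ (c ∧ s) ≡ s ∧ (i ∧ c)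
      rearrange = solve 3 (λ i c s → i :* (c :* s) := s :* (i :* c)) refl

    Joins : Fin m → Fin n → Fin n → Set
    Joins f x y = (src f ≡ x × tgt f ≡ y) ⊎ (src f ≡ y × tgt f ≡ x)

    cut-across : ∀ {f x y} → Joins f x y → ∀ e → cut e y ≡ cut e x xor δ e f
    cut-across {f} (inj₁ (refl , refl)) e = cut-step e f
    cut-across {f} (inj₂ (refl , refl)) e = begin
      cut e (src f)
        ≡⟨ solve 2 (λ c d → c := (c :+ d) :+ d) refl (cut e (src f)) (δ e f) ⟩
      (cut e (src f) xor δ e f) xor δ e f
        ≡⟨ cong (_xor δ e f) (sym (cut-step e f)) ⟩
      cut e (tgt f) xor δ e f ∎

    joins-endpoint : ∀ {f x y z} → Joins f x y → inc z f ≡ true → z ≡ x ⊎ z ≡ y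
    joins-endpoint {f} {z = z} joins z∈f with δ (src f) z in src≡z | joins
    ... | true  | inj₁ (refl , _) = inj₁ (sym (δ≡true⇒≡ src≡z))
    ... | true  | inj₂ (refl , _) = inj₂ (sym (δ≡true⇒≡ src≡z))
    ... | false | inj₁ (_ , refl) = inj₂ (sym (inc⇒tgt z∈f src≡z))
    ... | false | inj₂ (_ , refl) = inj₁ (sym (inc⇒tgt z∈f src≡z))

    other : Fin n → Fin m → Fin n
    other x f = if δ (src f) x then tgt f else src f

    joins-other : ∀ {x f} → inc x f ≡ true → Joins f x (other x f)
    joins-other {x} {f} x∈f with δ (src f) x in src≡x
    ... | true  = inj₁ (δ≡true⇒≡ src≡x , refl)
    ... | false = inj₂ (refl , inc⇒tgt x∈f src≡x)

    depth : Fin n → ℕ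
    depth x = ∣ tabulate (λ e → cut e x) ∣

    depth-root : depth r ≡ 0
    depth-root = ∣tabulate∣≡0 (λ e → cut e r) cut-root

    depth-across : ∀ {f x y} → Joins f x y → cut f x ≡ true → depth x ≡ suc (depth y)
    depth-across {f} {x} {y} joins f-below-x = ∣tabulate∣-insert (λ e → cut e x) (λ e → cut e y) f f-below-x f-above-y same
      where
      f-above-y : cut f y ≡ false
      f-above-y = trans (cut-across joins f) (trans (cong₂ _xor_ f-below-x (dec-true (f ≟ f) refl)) refl)
      same : ∀ e → e ≢ f → cut e x ≡ cut e y
      same e e≢f = sym (trans (cut-across joins e) (trans (cong (cut e x xor_) (dec-false (e ≟ f) e≢f)) (xor-identityʳ _)))

    ∂-path : ∀ x → x ≢ r → ∂ (λ e → cut e x) x ≡ true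
    ∂-path x x≢r = trans (∂-χ (connected r x) x) (cong₂ _xor_ (dec-false (r ≟ x) (≢-sym x≢r)) (dec-true (x ≟ x) refl))

    up-exists : ∀ x → x ≢ r → ∃ λ f → inc x f ≡ true × cut f x ≡ true
    up-exists x x≢r with f , f∈ ← parity≡true⇒∃ (λ e → inc x e ∧ cut e x) (∂-path x x≢r) = f , ∧≡true⇒ f∈

    cut⇒not-root : ∀ {e x} → cut e x ≡ true → x ≢ r
    cut⇒not-root {e} below refl with () ← trans (sym below) (cut-root e)

    shallower-ends : ∀ {f x y z} → Joins f x y → depth x ≡ suc (depth y) → inc z f ≡ true → depth z ≤ depth x
    shallower-ends {x = x} {y} joins deeper z∈f with joins-endpoint joins z∈f
    ... | inj₁ z≡x = ℕ.≤-reflexive (cong depth z≡x)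
    ... | inj₂ z≡y = subst (λ w → depth w ≤ depth x) (sym z≡y) (subst (depth y ≤_) (sym deeper) (ℕ.n≤1+n _))

    cut⇒endpoints-shallower : ∀ {h x z} → cut h x ≡ true → inc z h ≡ true → depth z ≤ depth x
    cut⇒endpoints-shallower {h} {x} {z} h-below-x z∈h = go (depth x) x ℕ.≤-refl h-below-x
      where
      go : ∀ k x → depth x ≤ k → cut h x ≡ true → depth z ≤ depth x
      go k x depth≤k h-below-x with f , x∈f , f-below-x ← up-exists x (cut⇒not-root h-below-x) with h ≟ f | k
      ... | yes h≡f | _ =
        shallower-ends (joins-other x∈f) (depth-across (joins-other x∈f) f-below-x) (subst (λ g → inc z g ≡ true) h≡f z∈h)
      ... | no h≢f | zero with () ← ℕ.≤-trans (ℕ.≤-reflexive (sym (depth-across (joins-other x∈f) f-below-x))) depth≤k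
      ... | no h≢f | suc k = ℕ.≤-trans (go k (other x f) (ℕ.≤-pred (subst (_≤ suc k) deeper depth≤k)) h-below-y)
                                        (subst (depth (other x f) ≤_) (sym deeper) (ℕ.n≤1+n _))
        where
        deeper : depth x ≡ suc (depth (other x f))
        deeper = depth-across (joins-other x∈f) f-below-x
        h-below-y : cut h (other x f) ≡ true
        h-below-y = trans (cut-across (joins-other x∈f) h) (cong₂ _xor_ h-below-x (dec-false (h ≟ f) h≢f))

    up-unique : ∀ {x f g} → inc x f ≡ true → inc x g ≡ true → cut f x ≡ true → cut g x ≡ true → f ≡ g
    up-unique {x} {f} {g} x∈f x∈g f-below-x g-below-x with f ≟ g
    ... | yes f≡g = f≡g
    ... | no  f≢g = contradiction (cut⇒endpoints-shallower g-below-y x∈g) (ℕ.<⇒≱ (ℕ.≤-reflexive (sym deeper)))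
      where
      deeper : depth x ≡ suc (depth (other x f))
      deeper = depth-across (joins-other x∈f) f-below-x
      g-below-y : cut g (other x f) ≡ true
      g-below-y = trans (cut-across (joins-other x∈f) g) (cong₂ _xor_ g-below-x (dec-false (g ≟ f) (≢-sym f≢g)))

    child : Fin m → Fin n
    child e = if cut e (src e) then src e else tgt e

    child-inc : ∀ e → inc (child e) e ≡ true
    child-inc e with cut e (src e)
    ... | true  = src-inc e
    ... | false = tgt-inc e

    child-cut : ∀ e → cut e (child e) ≡ true
    child-cut e with cut e (src e) in src-below
    ... | true  = src-below
    ... | false = trans (cut-step e e) (cong₂ _xor_ src-below (dec-true (e ≟ e) refl))

    child-unique : ∀ {e x} → inc x e ≡ true → cut e x ≡ true → child e ≡ x
    child-unique {e} {x} x∈e e-below-x with δ (src e) x in src≡x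
    ... | true with refl ← δ≡true⇒≡ {i = src e} {x} src≡x = cong (λ b → if b then src e else tgt e) e-below-x
    ... | false with refl ← inc⇒tgt {x} {e} x∈e src≡x with cut e (src e) in src-below
    ... | false = refl
    ... | true with () ← trans (sym e-below-x) (trans (cut-step e e) (cong₂ _xor_ src-below (dec-true (e ≟ e) refl)))

    suc-edges≡vertices : suc m ≡ n
    suc-edges≡vertices = suc≡-by-punctured-bijection r child (λ e → cut⇒not-root (child-cut e)) child-injective
      λ x x≢r → let f , x∈f , f-below-x = up-exists x x≢r in f , child-unique x∈f f-below-x
      where
      child-injective : ∀ {e e′} → child e ≡ child e′ → e ≡ e′
      child-injective {e} {e′} eq = up-unique (child-inc e) (subst (λ x → inc x e′ ≡ true) (sym eq) (child-inc e′))
        (child-cut e) (subst (λ x → cut e′ x ≡ true) (sym eq) (child-cut e′))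

open Trees

module LocalGeometry where

  open import Data.Rational using (ℚ; 0ℚ; 1ℚ; ½; _+_; _-_; _*_; -_; _≤_; _<_; _⊓_; _≤?_; _<?_; positive; nonNegative)
  import Data.Rational.Properties as ℚ
  open import Data.Rational.Solver using (module +-*-Solver)
  open import Relation.Binary.Definitions using (tri<; tri≈; tri>)
  open +-*-Solver

  private
    p≤q⇒0≤q-p : ∀ {p q} → p ≤ q → 0ℚ ≤ q - p
    p≤q⇒0≤q-p {p} {q} p≤q = subst (_≤ q - p) (ℚ.+-inverseʳ p) (ℚ.+-monoˡ-≤ (- p) p≤q)

    0≤q-p⇒p≤q : ∀ {p q} → 0ℚ ≤ q - p → p ≤ q
    0≤q-p⇒p≤q {p} {q} 0≤q-p = subst₂ _≤_ (ℚ.+-identityˡ p) (solve 2 (λ p q → (q :- p) :+ p := q) refl p q) (ℚ.+-monoˡ-≤ p 0≤q-p)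

    p<q⇒0<q-p : ∀ {p q} → p < q → 0ℚ < q - p
    p<q⇒0<q-p {p} {q} p<q = subst (_< q - p) (ℚ.+-inverseʳ p) (ℚ.+-monoˡ-< (- p) p<q)

    0<q-p⇒p<q : ∀ {p q} → 0ℚ < q - p → p < q
    0<q-p⇒p<q {p} {q} 0<q-p = subst₂ _<_ (ℚ.+-identityˡ p) (solve 2 (λ p q → (q :- p) :+ p := q) refl p q) (ℚ.+-monoˡ-< p 0<q-p)

    0≤p*q : ∀ {p q} → 0ℚ ≤ p → 0ℚ ≤ q → 0ℚ ≤ p * q
    0≤p*q {p} {q} 0≤p 0≤q = subst (_≤ p * q) (ℚ.*-zeroˡ q) (ℚ.*-monoʳ-≤-nonNeg q {{nonNegative 0≤q}} 0≤p)

    0<p*q : ∀ {p q} → 0ℚ < p → 0ℚ < q → 0ℚ < p * q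
    0<p*q {p} {q} 0<p 0<q = subst (_< p * q) (ℚ.*-zeroˡ q) (ℚ.*-monoˡ-<-pos q {{positive 0<q}} 0<p)


  0≤½ : 0ℚ ≤ ½
  0≤½ = from-yes (0ℚ ≤? ½)

  0<½ : 0ℚ < ½
  0<½ = from-yes (0ℚ <? ½)

  ½<1 : ½ < 1ℚ
  ½<1 = from-yes (½ <? 1ℚ)

  ≤∧≢⇒< : ∀ {p q} → p ≤ q → p ≢ q → p < q
  ≤∧≢⇒< {p} {q} p≤q p≢q with ℚ.<-cmp p q
  ... | tri< p<q _ _ = p<q
  ... | tri≈ _ p≡q _ = contradiction p≡q p≢q
  ... | tri> _ _ q<p = contradiction (ℚ.<-≤-trans q<p p≤q) (ℚ.<-irrefl refl)

  -- the tetrahedron with vertices (0, 0, 0), (½, ½, 0), (½, 0, ½) and (0, ½, ½)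
  InTetrahedron : ℚ → ℚ → ℚ → Set
  InTetrahedron a b c = (a ≤ b + c) × (b ≤ a + c) × (c ≤ a + b) × (a + b + c ≤ 1ℚ)

  tetrahedron-bounds : ∀ {a b c} → InTetrahedron a b c → 0ℚ ≤ a × a ≤ ½
  tetrahedron-bounds {a} {b} {c} (a≤b+c , b≤a+c , c≤a+b , a+b+c≤1) =
    subst (0ℚ ≤_) (solve 3 (λ a b c → con ½ :* (((a :+ c) :- b) :+ ((a :+ b) :- c)) := a) refl a b c)
      (0≤p*q 0≤½ (ℚ.+-mono-≤ (p≤q⇒0≤q-p b≤a+c) (p≤q⇒0≤q-p c≤a+b))) ,
    0≤q-p⇒p≤q (subst (0ℚ ≤_) (solve 3 (λ a b c → con ½ :* ((con 1ℚ :- (a :+ b :+ c)) :+ ((b :+ c) :- a)) := con ½ :- a) refl a b c)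
      (0≤p*q 0≤½ (ℚ.+-mono-≤ (p≤q⇒0≤q-p a+b+c≤1) (p≤q⇒0≤q-p a≤b+c))))

  tetrahedron-rotate : ∀ {a b c} → InTetrahedron a b c → InTetrahedron b c a
  tetrahedron-rotate {a} {b} {c} (a≤b+c , b≤a+c , c≤a+b , a+b+c≤1) =
    subst (b ≤_) (ℚ.+-comm a c) b≤a+c , subst (c ≤_) (ℚ.+-comm a b) c≤a+b , a≤b+c ,
    subst (_≤ 1ℚ) (solve 3 (λ a b c → a :+ b :+ c := b :+ c :+ a) refl a b c) a+b+c≤1

  ½if : Bool → ℚ
  ½if true  = ½
  ½if false = 0ℚ

  ½if-bounds : ∀ x → 0ℚ ≤ ½if x × ½if x ≤ ½
  ½if-bounds true  = 0≤½ , ℚ.≤-refl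
  ½if-bounds false = ℚ.≤-refl , 0≤½

  ½if-cases : ∀ x → ½if x ≡ 0ℚ ⊎ ½if x ≡ ½
  ½if-cases true  = inj₂ refl
  ½if-cases false = inj₁ refl

  ½if-tetrahedron⇒even : ∀ x y z → InTetrahedron (½if x) (½if y) (½if z) → x xor (y xor z) ≡ false
  ½if-tetrahedron⇒even false false false _ = refl
  ½if-tetrahedron⇒even true  true  false _ = refl
  ½if-tetrahedron⇒even true  false true  _ = refl
  ½if-tetrahedron⇒even false true  true  _ = refl
  ½if-tetrahedron⇒even true  true  true  (_ , _ , _ , sum≤1) = contradiction sum≤1 (from-no (½ + ½ + ½ ≤? 1ℚ))
  ½if-tetrahedron⇒even true  false false (a≤b+c , _) = contradiction a≤b+c (from-no (½ ≤? 0ℚ + 0ℚ))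
  ½if-tetrahedron⇒even false true  false (_ , b≤a+c , _) = contradiction b≤a+c (from-no (½ ≤? 0ℚ + 0ℚ))
  ½if-tetrahedron⇒even false false true  (_ , _ , c≤a+b , _) = contradiction c≤a+b (from-no (½ ≤? 0ℚ + 0ℚ))

  even⇒½if-tetrahedron : ∀ x y z → x xor (y xor z) ≡ false → InTetrahedron (½if x) (½if y) (½if z)
  even⇒½if-tetrahedron false false false _ =
    from-yes (0ℚ ≤? 0ℚ + 0ℚ) , from-yes (0ℚ ≤? 0ℚ + 0ℚ) , from-yes (0ℚ ≤? 0ℚ + 0ℚ) , from-yes (0ℚ + 0ℚ + 0ℚ ≤? 1ℚ)
  even⇒½if-tetrahedron true  true  false _ =
    from-yes (½ ≤? ½ + 0ℚ) , from-yes (½ ≤? ½ + 0ℚ) , from-yes (0ℚ ≤? ½ + ½) , from-yes (½ + ½ + 0ℚ ≤? 1ℚ)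
  even⇒½if-tetrahedron true  false true  _ =
    from-yes (½ ≤? 0ℚ + ½) , from-yes (0ℚ ≤? ½ + ½) , from-yes (½ ≤? ½ + 0ℚ) , from-yes (½ + 0ℚ + ½ ≤? 1ℚ)
  even⇒½if-tetrahedron false true  true  _ =
    from-yes (0ℚ ≤? ½ + ½) , from-yes (½ ≤? 0ℚ + ½) , from-yes (½ ≤? 0ℚ + ½) , from-yes (0ℚ + ½ + ½ ≤? 1ℚ)

  signed : Bool → ℚ → ℚ
  signed true  t = t - ½
  signed false t = - t

  -- For x xor y xor z ≡ false, the slack at (a, b, c) of the one facet inequality of the
  -- tetrahedron that the vertex (½if x, ½if y, ½if z) does not satisfy with equality.
  slack : Bool → Bool → Bool → ℚ → ℚ → ℚ → ℚ
  slack x y z a b c = 1ℚ + (signed x a + (signed y b + signed z c))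

  slack-rotate : ∀ x y z a b c → slack y z x b c a ≡ slack x y z a b c
  slack-rotate x y z a b c =
    solve 3 (λ p q r → con 1ℚ :+ (q :+ (r :+ p)) := con 1ℚ :+ (p :+ (q :+ r))) refl (signed x a) (signed y b) (signed z c)

  parity-rotate : ∀ x y z → y xor (z xor x) ≡ x xor (y xor z)
  parity-rotate x y z = trans (sym (xor-assoc y z x)) (xor-comm (y xor z) x)

  slack-nonneg : ∀ {a b c} x y z → InTetrahedron a b c → x xor (y xor z) ≡ false → 0ℚ ≤ slack x y z a b c
  slack-nonneg {a} {b} {c} false false false (_ , _ , _ , a+b+c≤1) _ =
    subst (0ℚ ≤_) (solve 3 (λ a b c → con 1ℚ :- (a :+ b :+ c) := con 1ℚ :+ (:- a :+ (:- b :+ :- c))) refl a b c) (p≤q⇒0≤q-p a+b+c≤1)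
  slack-nonneg {a} {b} {c} true true false (_ , _ , c≤a+b , _) _ =
    subst (0ℚ ≤_) (solve 3 (λ a b c → (a :+ b) :- c := con 1ℚ :+ ((a :- con ½) :+ ((b :- con ½) :+ :- c))) refl a b c) (p≤q⇒0≤q-p c≤a+b)
  slack-nonneg {a} {b} {c} true false true (_ , b≤a+c , _ , _) _ =
    subst (0ℚ ≤_) (solve 3 (λ a b c → (a :+ c) :- b := con 1ℚ :+ ((a :- con ½) :+ (:- b :+ (c :- con ½)))) refl a b c) (p≤q⇒0≤q-p b≤a+c)
  slack-nonneg {a} {b} {c} false true true (a≤b+c , _ , _ , _) _ =
    subst (0ℚ ≤_) (solve 3 (λ a b c → (b :+ c) :- a := con 1ℚ :+ (:- a :+ ((b :- con ½) :+ (c :- con ½)))) refl a b c) (p≤q⇒0≤q-p a≤b+c)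

  slack-complement : ∀ x y z a b c → slack x y z a b c + slack x (not y) (not z) a b c ≡ 1ℚ + (signed x a + signed x a)
  slack-complement x true  true  a b c = solve 3 (λ s b c →
    con 1ℚ :+ (s :+ ((b :- con ½) :+ (c :- con ½))) :+ (con 1ℚ :+ (s :+ (:- b :+ :- c))) := con 1ℚ :+ (s :+ s)) refl (signed x a) b c
  slack-complement x true  false a b c = solve 3 (λ s b c →
    con 1ℚ :+ (s :+ ((b :- con ½) :+ :- c)) :+ (con 1ℚ :+ (s :+ (:- b :+ (c :- con ½)))) := con 1ℚ :+ (s :+ s)) refl (signed x a) b c
  slack-complement x false true  a b c = solve 3 (λ s b c →
    con 1ℚ :+ (s :+ (:- b :+ (c :- con ½))) :+ (con 1ℚ :+ (s :+ ((b :- con ½) :+ :- c))) := con 1ℚ :+ (s :+ s)) refl (signed x a) b c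
  slack-complement x false false a b c = solve 3 (λ s b c →
    con 1ℚ :+ (s :+ (:- b :+ :- c)) :+ (con 1ℚ :+ (s :+ ((b :- con ½) :+ (c :- con ½)))) := con 1ℚ :+ (s :+ s)) refl (signed x a) b c

  -- t is not the endpoint ½if (not x) of [0, ½]
  Available : Bool → ℚ → Set
  Available true  t = 0ℚ < t
  Available false t = t < ½

  available⇒ : ∀ x {t} → Available x t → 0ℚ < 1ℚ + (signed x t + signed x t)
  available⇒ true  {t} 0<t = subst (0ℚ <_) (solve 1 (λ t → t :+ t := con 1ℚ :+ ((t :- con ½) :+ (t :- con ½))) refl t) (ℚ.+-mono-< 0<t 0<t)
  available⇒ false {t} t<½ = subst (0ℚ <_) (solve 1 (λ t → (con ½ :- t) :+ (con ½ :- t) := con 1ℚ :+ (:- t :+ :- t)) refl t)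
    (ℚ.+-mono-< (p<q⇒0<q-p t<½) (p<q⇒0<q-p t<½))

  ⇒available : ∀ x {t} → 0ℚ < 1ℚ + (signed x t + signed x t) → Available x t
  ⇒available true  {t} 0<2t = subst (0ℚ <_) (solve 1 (λ t → con ½ :* (con 1ℚ :+ ((t :- con ½) :+ (t :- con ½))) := t) refl t) (0<p*q 0<½ 0<2t)
  ⇒available false {t} 0<1-2t = 0<q-p⇒p<q (subst (0ℚ <_) (solve 1 (λ t → con ½ :* (con 1ℚ :+ (:- t :+ :- t)) := con ½ :- t) refl t)
    (0<p*q 0<½ 0<1-2t))

  slack⇒available : ∀ {a b c} x y z → InTetrahedron a b c → x xor (y xor z) ≡ false → 0ℚ < slack x y z a b c → Available x a
  slack⇒available {a} {b} {c} x y z tetra even 0<slack = ⇒available x (subst (0ℚ <_) (slack-complement x y z a b c)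
    (ℚ.+-mono-<-≤ 0<slack (slack-nonneg x (not y) (not z) tetra (trans (cong (x xor_) (xor-annihilates-not y z)) even))))

  slack⇒all-available : ∀ {a b c} x y z → InTetrahedron a b c → x xor (y xor z) ≡ false → 0ℚ < slack x y z a b c →
                        Available x a × Available y b × Available z c
  slack⇒all-available {a} {b} {c} x y z tetra even 0<slack =
    slack⇒available x y z tetra even 0<slack ,
    slack⇒available y z x tetra′ even′ 0<slack′ ,
    slack⇒available z x y (tetrahedron-rotate tetra′) (trans (parity-rotate y z x) even′)
                    (subst (0ℚ <_) (sym (slack-rotate y z x b c a)) 0<slack′)
    where
    tetra′ : InTetrahedron b c a
    tetra′ = tetrahedron-rotate tetra
    even′ : y xor (z xor x) ≡ false
    even′ = trans (parity-rotate x y z) even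
    0<slack′ : 0ℚ < slack y z x b c a
    0<slack′ = subst (0ℚ <_) (sym (slack-rotate x y z a b c)) 0<slack

  -- opaque, so that `with positive? q` can abstract it in goals about choose and clip
  opaque
    positive? : ∀ q → Dec (0ℚ < q)
    positive? q = 0ℚ <? q

  choose : Bool → ℚ → ℚ → ℚ → Bool × Bool
  choose x a b c = if does (positive? (slack x x false a b c)) then (x , false) else (not x , true)

  choose-even : ∀ x a b c → x xor (proj₁ (choose x a b c) xor proj₂ (choose x a b c)) ≡ false
  choose-even x a b c with positive? (slack x x false a b c)
  ... | yes _ = first x
    where
    first : ∀ x → x xor (x xor false) ≡ false
    first true  = refl
    first false = refl
  ... | no  _ = second x
    where
    second : ∀ x → x xor (not x xor true) ≡ false
    second true  = refl
    second false = refl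

  choose-slack : ∀ x a b c → Available x a → 0ℚ < slack x (proj₁ (choose x a b c)) (proj₂ (choose x a b c)) a b c
  choose-slack x a b c available with positive? (slack x x false a b c)
  ... | yes 0<slack = 0<slack
  ... | no  ¬0<slack = subst (0ℚ <_) rest (ℚ.+-mono-<-≤ (available⇒ x available) (p≤q⇒0≤q-p (ℚ.≮⇒≥ ¬0<slack)))
    where
    rest : 1ℚ + (signed x a + signed x a) + (0ℚ - slack x x false a b c) ≡ slack x (not x) true a b c
    rest = trans (cong (_+ (0ℚ - slack x x false a b c)) (sym (slack-complement x x false a b c)))
      (solve 2 (λ s t → s :+ t :+ (con 0ℚ :- s) := t) refl (slack x x false a b c) (slack x (not x) true a b c))

  affine : ℚ → ℚ → ℚ → ℚ
  affine t p q = (1ℚ - t) * p + t * q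

  private
    F₁ F₂ F₃ F₄ : ℚ → ℚ → ℚ → ℚ
    F₁ a b c = (b + c) - a
    F₂ a b c = (a + c) - b
    F₃ a b c = (a + b) - c
    F₄ a b c = 1ℚ - (a + b + c)

    module _ (t a b c a′ b′ c′ : ℚ) where
      A B C : ℚ
      A = affine t a a′
      B = affine t b b′
      C = affine t c c′

      F₁-affine : F₁ A B C ≡ (1ℚ - t) * F₁ a b c + t * F₁ a′ b′ c′
      F₁-affine = solve 7 (λ t a b c a′ b′ c′ →
        ((con 1ℚ :- t) :* b :+ t :* b′ :+ ((con 1ℚ :- t) :* c :+ t :* c′)) :- ((con 1ℚ :- t) :* a :+ t :* a′)
        := (con 1ℚ :- t) :* ((b :+ c) :- a) :+ t :* ((b′ :+ c′) :- a′)) refl t a b c a′ b′ c′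

      F₂-affine : F₂ A B C ≡ (1ℚ - t) * F₂ a b c + t * F₂ a′ b′ c′
      F₂-affine = solve 7 (λ t a b c a′ b′ c′ →
        ((con 1ℚ :- t) :* a :+ t :* a′ :+ ((con 1ℚ :- t) :* c :+ t :* c′)) :- ((con 1ℚ :- t) :* b :+ t :* b′)
        := (con 1ℚ :- t) :* ((a :+ c) :- b) :+ t :* ((a′ :+ c′) :- b′)) refl t a b c a′ b′ c′

      F₃-affine : F₃ A B C ≡ (1ℚ - t) * F₃ a b c + t * F₃ a′ b′ c′
      F₃-affine = solve 7 (λ t a b c a′ b′ c′ →
        ((con 1ℚ :- t) :* a :+ t :* a′ :+ ((con 1ℚ :- t) :* b :+ t :* b′)) :- ((con 1ℚ :- t) :* c :+ t :* c′)
        := (con 1ℚ :- t) :* ((a :+ b) :- c) :+ t :* ((a′ :+ b′) :- c′)) refl t a b c a′ b′ c′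

      F₄-affine : F₄ A B C ≡ (1ℚ - t) * F₄ a b c + t * F₄ a′ b′ c′
      F₄-affine = solve 7 (λ t a b c a′ b′ c′ →
        con 1ℚ :- ((con 1ℚ :- t) :* a :+ t :* a′ :+ ((con 1ℚ :- t) :* b :+ t :* b′) :+ ((con 1ℚ :- t) :* c :+ t :* c′))
        := (con 1ℚ :- t) :* (con 1ℚ :- (a :+ b :+ c)) :+ t :* (con 1ℚ :- (a′ :+ b′ :+ c′))) refl t a b c a′ b′ c′

    FacetCondition : ℚ → ℚ → ℚ → Set
    FacetCondition ε f f′ = f′ ≡ 0ℚ ⊎ (f′ ≡ 1ℚ × ε ≤ f)

    facet-preserved : ∀ {ε f f′} → 0ℚ ≤ ε → ε ≤ 1ℚ → 0ℚ ≤ f → FacetCondition ε f f′ →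
                      0ℚ ≤ (1ℚ - ε) * f + ε * f′ × 0ℚ ≤ (1ℚ - - ε) * f + - ε * f′
    facet-preserved {ε} {f} 0≤ε ε≤1 0≤f (inj₁ refl) =
      subst (0ℚ ≤_) (solve 2 (λ ε f → (con 1ℚ :- ε) :* f := (con 1ℚ :- ε) :* f :+ ε :* con 0ℚ) refl ε f)
        (0≤p*q (p≤q⇒0≤q-p ε≤1) 0≤f) ,
      subst (0ℚ ≤_) (solve 2 (λ ε f → f :+ ε :* f := (con 1ℚ :- :- ε) :* f :+ :- ε :* con 0ℚ) refl ε f)
        (ℚ.+-mono-≤ 0≤f (0≤p*q 0≤ε 0≤f))
    facet-preserved {ε} {f} 0≤ε ε≤1 0≤f (inj₂ (refl , ε≤f)) =
      subst (0ℚ ≤_) (solve 2 (λ ε f → (con 1ℚ :- ε) :* f :+ ε := (con 1ℚ :- ε) :* f :+ ε :* con 1ℚ) refl ε f)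
        (ℚ.+-mono-≤ (0≤p*q (p≤q⇒0≤q-p ε≤1) 0≤f) 0≤ε) ,
      subst (0ℚ ≤_) (solve 2 (λ ε f → (f :- ε) :+ ε :* f := (con 1ℚ :- :- ε) :* f :+ :- ε :* con 1ℚ) refl ε f)
        (ℚ.+-mono-≤ (p≤q⇒0≤q-p ε≤f) (0≤p*q 0≤ε 0≤f))

    affine-tetrahedron : ∀ {a b c a′ b′ c′ ε} → InTetrahedron a b c → 0ℚ ≤ ε → ε ≤ 1ℚ →
      FacetCondition ε (F₁ a b c) (F₁ a′ b′ c′) → FacetCondition ε (F₂ a b c) (F₂ a′ b′ c′) →
      FacetCondition ε (F₃ a b c) (F₃ a′ b′ c′) → FacetCondition ε (F₄ a b c) (F₄ a′ b′ c′) →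
      InTetrahedron (affine ε a a′) (affine ε b b′) (affine ε c c′) ×
      InTetrahedron (affine (- ε) a a′) (affine (- ε) b b′) (affine (- ε) c c′)
    affine-tetrahedron {a} {b} {c} {a′} {b′} {c′} {ε} (a≤b+c , b≤a+c , c≤a+b , a+b+c≤1) 0≤ε ε≤1 cond₁ cond₂ cond₃ cond₄ =
      (0≤q-p⇒p≤q (subst (0ℚ ≤_) (sym (F₁-affine ε a b c a′ b′ c′)) (proj₁ facet₁)) ,
       0≤q-p⇒p≤q (subst (0ℚ ≤_) (sym (F₂-affine ε a b c a′ b′ c′)) (proj₁ facet₂)) ,
       0≤q-p⇒p≤q (subst (0ℚ ≤_) (sym (F₃-affine ε a b c a′ b′ c′)) (proj₁ facet₃)) ,
       0≤q-p⇒p≤q (subst (0ℚ ≤_) (sym (F₄-affine ε a b c a′ b′ c′)) (proj₁ facet₄))) ,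
      (0≤q-p⇒p≤q (subst (0ℚ ≤_) (sym (F₁-affine (- ε) a b c a′ b′ c′)) (proj₂ facet₁)) ,
       0≤q-p⇒p≤q (subst (0ℚ ≤_) (sym (F₂-affine (- ε) a b c a′ b′ c′)) (proj₂ facet₂)) ,
       0≤q-p⇒p≤q (subst (0ℚ ≤_) (sym (F₃-affine (- ε) a b c a′ b′ c′)) (proj₂ facet₃)) ,
       0≤q-p⇒p≤q (subst (0ℚ ≤_) (sym (F₄-affine (- ε) a b c a′ b′ c′)) (proj₂ facet₄)))
      where
      Preserved : ℚ → ℚ → Set
      Preserved f f′ = 0ℚ ≤ (1ℚ - ε) * f + ε * f′ × 0ℚ ≤ (1ℚ - - ε) * f + - ε * f′
      facet₁ : Preserved (F₁ a b c) (F₁ a′ b′ c′)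
      facet₁ = facet-preserved 0≤ε ε≤1 (p≤q⇒0≤q-p a≤b+c) cond₁
      facet₂ : Preserved (F₂ a b c) (F₂ a′ b′ c′)
      facet₂ = facet-preserved 0≤ε ε≤1 (p≤q⇒0≤q-p b≤a+c) cond₂
      facet₃ : Preserved (F₃ a b c) (F₃ a′ b′ c′)
      facet₃ = facet-preserved 0≤ε ε≤1 (p≤q⇒0≤q-p c≤a+b) cond₃
      facet₄ : Preserved (F₄ a b c) (F₄ a′ b′ c′)
      facet₄ = facet-preserved 0≤ε ε≤1 (p≤q⇒0≤q-p a+b+c≤1) cond₄

  perturb : ∀ {a b c ε} x y z → InTetrahedron a b c → x xor (y xor z) ≡ false → 0ℚ ≤ ε → ε ≤ 1ℚ → ε ≤ slack x y z a b c →
    InTetrahedron (affine ε a (½if x)) (affine ε b (½if y)) (affine ε c (½if z)) ×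
    InTetrahedron (affine (- ε) a (½if x)) (affine (- ε) b (½if y)) (affine (- ε) c (½if z))
  perturb {a} {b} {c} {ε} false false false tetra _ 0≤ε ε≤1 ε≤slack =
    affine-tetrahedron tetra 0≤ε ε≤1 (inj₁ refl) (inj₁ refl) (inj₁ refl)
      (inj₂ (refl , subst (ε ≤_) (solve 3 (λ a b c → con 1ℚ :+ (:- a :+ (:- b :+ :- c)) := con 1ℚ :- (a :+ b :+ c)) refl a b c) ε≤slack))
  perturb {a} {b} {c} {ε} true true false tetra _ 0≤ε ε≤1 ε≤slack =
    affine-tetrahedron tetra 0≤ε ε≤1 (inj₁ refl) (inj₁ refl)
      (inj₂ (refl , subst (ε ≤_) (solve 3 (λ a b c → con 1ℚ :+ ((a :- con ½) :+ ((b :- con ½) :+ :- c)) := (a :+ b) :- c) refl a b c) ε≤slack))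
      (inj₁ refl)
  perturb {a} {b} {c} {ε} true false true tetra _ 0≤ε ε≤1 ε≤slack =
    affine-tetrahedron tetra 0≤ε ε≤1 (inj₁ refl)
      (inj₂ (refl , subst (ε ≤_) (solve 3 (λ a b c → con 1ℚ :+ ((a :- con ½) :+ (:- b :+ (c :- con ½))) := (a :+ c) :- b) refl a b c) ε≤slack))
      (inj₁ refl) (inj₁ refl)
  perturb {a} {b} {c} {ε} false true true tetra _ 0≤ε ε≤1 ε≤slack =
    affine-tetrahedron tetra 0≤ε ε≤1
      (inj₂ (refl , subst (ε ≤_) (solve 3 (λ a b c → con 1ℚ :+ (:- a :+ ((b :- con ½) :+ (c :- con ½))) := (b :+ c) :- a) refl a b c) ε≤slack))
      (inj₁ refl) (inj₁ refl) (inj₁ refl)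

  affine-midpoint : ∀ ε w u → w ≡ ½ * affine (- ε) w u + (1ℚ - ½) * affine ε w u
  affine-midpoint ε w u = solve 3 (λ ε w u →
    w := con ½ :* ((con 1ℚ :- :- ε) :* w :+ :- ε :* u) :+ (con 1ℚ :- con ½) :* ((con 1ℚ :- ε) :* w :+ ε :* u)) refl ε w u

  private
    product-zero : ∀ {t x} → 0ℚ < t → t * x ≡ 0ℚ → x ≡ 0ℚ
    product-zero {t} 0<t tx≡0 = ℚ.≤-antisym
      (ℚ.*-cancelˡ-≤-pos t {{positive 0<t}} (ℚ.≤-reflexive (trans tx≡0 (sym (ℚ.*-zeroʳ t)))))
      (ℚ.*-cancelˡ-≤-pos t {{positive 0<t}} (ℚ.≤-reflexive (trans (ℚ.*-zeroʳ t) (sym tx≡0))))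

    sum-zero : ∀ {p q} → 0ℚ ≤ p → 0ℚ ≤ q → p + q ≡ 0ℚ → p ≡ 0ℚ × q ≡ 0ℚ
    sum-zero {p} {q} 0≤p 0≤q p+q≡0 =
      ℚ.≤-antisym (subst (p ≤_) p+q≡0 (0≤q-p⇒p≤q (subst (0ℚ ≤_) (solve 2 (λ p q → q := (p :+ q) :- p) refl p q) 0≤q))) 0≤p ,
      ℚ.≤-antisym (subst (q ≤_) p+q≡0 (0≤q-p⇒p≤q (subst (0ℚ ≤_) (solve 2 (λ p q → p := (p :+ q) :- q) refl p q) 0≤p))) 0≤q

    convex-zero : ∀ {t x y} → 0ℚ < t → t < 1ℚ → 0ℚ ≤ x → 0ℚ ≤ y → t * x + (1ℚ - t) * y ≡ 0ℚ → x ≡ 0ℚ × y ≡ 0ℚ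
    convex-zero 0<t t<1 0≤x 0≤y sum≡0 =
      let tx≡0 , sy≡0 = sum-zero (0≤p*q (ℚ.<⇒≤ 0<t) 0≤x) (0≤p*q (ℚ.<⇒≤ (p<q⇒0<q-p t<1)) 0≤y) sum≡0
      in product-zero 0<t tx≡0 , product-zero (p<q⇒0<q-p t<1) sy≡0

  extreme-coordinate : ∀ {t x y w} → 0ℚ < t → t < 1ℚ → 0ℚ ≤ x → x ≤ ½ → 0ℚ ≤ y → y ≤ ½ →
                       w ≡ t * x + (1ℚ - t) * y → w ≡ 0ℚ ⊎ w ≡ ½ → x ≡ y
  extreme-coordinate 0<t t<1 0≤x _ 0≤y _ w≡ (inj₁ w≡0) =
    let x≡0 , y≡0 = convex-zero 0<t t<1 0≤x 0≤y (trans (sym w≡) w≡0) in trans x≡0 (sym y≡0)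
  extreme-coordinate {t} {x} {y} {w} 0<t t<1 _ x≤½ _ y≤½ w≡ (inj₂ w≡½) =
    let ½-x≡0 , ½-y≡0 = convex-zero 0<t t<1 (p≤q⇒0≤q-p x≤½) (p≤q⇒0≤q-p y≤½) gaps in trans (back ½-x≡0) (sym (back ½-y≡0))
    where
    gaps : t * (½ - x) + (1ℚ - t) * (½ - y) ≡ 0ℚ
    gaps = trans (solve 3 (λ t x y → t :* (con ½ :- x) :+ (con 1ℚ :- t) :* (con ½ :- y) := con ½ :- (t :* x :+ (con 1ℚ :- t) :* y)) refl t x y)
                 (trans (cong (λ z → ½ - z) (trans (sym w≡) w≡½)) (ℚ.+-inverseʳ ½))
    back : ∀ {z} → ½ - z ≡ 0ℚ → z ≡ ½
    back {z} ½-z≡0 = trans (solve 1 (λ z → z := con ½ :- (con ½ :- z)) refl z) (trans (cong (λ z → ½ - z) ½-z≡0) (ℚ.+-identityʳ ½))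

  affine-injective : ∀ {ε w u} → 0ℚ < ε → affine (- ε) w u ≡ affine ε w u → w ≡ u
  affine-injective {ε} {w} {u} 0<ε same = trans (solve 2 (λ w u → w := (w :- u) :+ u) refl w u) (trans (cong (_+ u) w-u≡0) (ℚ.+-identityˡ u))
    where
    w-u≡0 : w - u ≡ 0ℚ
    w-u≡0 = product-zero (ℚ.+-mono-< 0<ε 0<ε)
      (trans (solve 3 (λ ε w u → (ε :+ ε) :* (w :- u) := ((con 1ℚ :- :- ε) :* w :+ :- ε :* u) :- ((con 1ℚ :- ε) :* w :+ ε :* u)) refl ε w u)
             (trans (cong (_- affine ε w u) same) (ℚ.+-inverseʳ (affine ε w u))))

  interior-point : ∀ {w} → 0ℚ ≤ w → w ≤ ½ → w ≢ 0ℚ → w ≢ ½ →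
                   0ℚ < w + w × w + w < 1ℚ × w ≡ (w + w) * ½ + (1ℚ - (w + w)) * 0ℚ
  interior-point {w} 0≤w w≤½ w≢0 w≢½ = ℚ.+-mono-< 0<w 0<w , ℚ.+-mono-< w<½ w<½ ,
    solve 1 (λ w → w := (w :+ w) :* con ½ :+ (con 1ℚ :- (w :+ w)) :* con 0ℚ) refl w
    where
    0<w : 0ℚ < w
    0<w = ≤∧≢⇒< 0≤w (w≢0 ∘ sym)
    w<½ : w < ½
    w<½ = ≤∧≢⇒< w≤½ w≢½

  minimum : ∀ {k : ℕ} → (Fin k → ℚ) → ℚ
  minimum {zero}  f = 1ℚ
  minimum {suc k} f = f zero ⊓ minimum (f ∘ suc)

  minimum-pos : ∀ {k} (f : Fin k → ℚ) → (∀ i → 0ℚ < f i) → 0ℚ < minimum f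
  minimum-pos {zero}  f _   = from-yes (0ℚ <? 1ℚ)
  minimum-pos {suc k} f pos with ℚ.⊓-sel (f zero) (minimum (f ∘ suc))
  ... | inj₁ min≡ = subst (0ℚ <_) (sym min≡) (pos zero)
  ... | inj₂ min≡ = subst (0ℚ <_) (sym min≡) (minimum-pos (f ∘ suc) (pos ∘ suc))

  minimum-≤ : ∀ {k} (f : Fin k → ℚ) i → minimum f ≤ f i
  minimum-≤ {suc k} f zero    = ℚ.p⊓q≤p (f zero) _
  minimum-≤ {suc k} f (suc i) = ℚ.≤-trans (ℚ.p⊓q≤q (f zero) _) (minimum-≤ (f ∘ suc) i)

  minimum-≤1 : ∀ {k} (f : Fin k → ℚ) → minimum f ≤ 1ℚ
  minimum-≤1 {zero}  f = ℚ.≤-refl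
  minimum-≤1 {suc k} f = ℚ.≤-trans (ℚ.p⊓q≤q (f zero) _) (minimum-≤1 (f ∘ suc))

  clip : ℚ → ℚ
  clip q = if does (positive? q) then q else 1ℚ

  clip-pos : ∀ q → 0ℚ < clip q
  clip-pos q with positive? q
  ... | yes 0<q = 0<q
  ... | no  _   = from-yes (0ℚ <? 1ℚ)

  clip-≡ : ∀ {q} → 0ℚ < q → clip q ≡ q
  clip-≡ {q} 0<q with positive? q
  ... | yes _   = refl
  ... | no  ¬0<q = contradiction 0<q ¬0<q

open LocalGeometry

module Polytope (T : Graph) (t13 : Is13Tree T) where
  open import Data.Rational using (ℚ; 0ℚ; 1ℚ; ½; _+_; _-_; _*_; -_; _≤_; _<_)
  import Data.Rational.Properties as ℚ

  open Graph T
  open Walks T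

  connected : Connected T
  connected = proj₁ (proj₂ (proj₁ t13))

  acyclic : Acyclic T
  acyclic = proj₂ (proj₂ (proj₁ t13))

  open Forest T acyclic

  Triple : Fin n → Fin m → Fin m → Fin m → Set
  Triple v = Distinct₃ (incident T v)

  ∈⇒inc : ∀ {v e} → e ∈ incident T v → inc v e ≡ true
  ∈⇒inc = []=⇒lookup

  inc⇒∈ : ∀ {v e} → inc v e ≡ true → e ∈ incident T v
  inc⇒∈ {v} {e} = lookup⇒[]= e (incident T v)

  src∈ : ∀ e → e ∈ incident T (src e)
  src∈ e = inc⇒∈ (src-inc e)

  tgt∈ : ∀ e → e ∈ incident T (tgt e)
  tgt∈ e = inc⇒∈ (tgt-inc e)

  leaf-unique : ∀ {v e f} → IsLeaf T v → e ∈ incident T v → f ∈ incident T v → e ≡ f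
  leaf-unique = ∣p∣≡1⇒unique

  some-triple : ∀ {v} → IsInternal T v → ∃ λ a → ∃₂ λ b c → Triple v a b c
  some-triple d with a , a∈ ← ∣p∣≡suc⇒∃∈ _ d = a , ∣p∣≡3⇒Distinct₃ d a∈

  xor-commutativeMonoid : CommutativeMonoid 0ℓ 0ℓ
  xor-commutativeMonoid = Semiring.+-commutativeMonoid (CommutativeRing.semiring xor-∧-commutativeRing)

  parity-at : ∀ {v a b c} → IsInternal T v → Triple v a b c → ∀ D → ∂ D v ≡ D a xor (D b xor D c)
  parity-at {v} d t D = trans (⊕.sum-cong-≗ λ e → ∧-as-if (inc v e) (D e)) (sum-Distinct₃ d xor-commutativeMonoid t D)

  module ℚΣ = CommutativeMonoidSum ℚ.+-0-commutativeMonoid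

  slackAt : (Fin m → Bool) → (Fin m → ℚ) → Fin n → ℚ
  slackAt J w v = 1ℚ + ℚΣ.sum (λ e → if inc v e then signed (J e) (w e) else 0ℚ)

  slackAt-triple : ∀ {v a b c} → IsInternal T v → Triple v a b c → ∀ J w →
                   slackAt J w v ≡ slack (J a) (J b) (J c) (w a) (w b) (w c)
  slackAt-triple d t J w = cong (1ℚ +_) (sum-Distinct₃ d ℚ.+-0-commutativeMonoid t (λ e → signed (J e) (w e)))

  tetrahedron-at : ∀ w {v a b c} → InP T w → IsInternal T v → Triple v a b c →
                   InTetrahedron (lookup w a) (lookup w b) (lookup w c)
  tetrahedron-at _ (node , _) d t = node _ d _ _ _ a∈p b∈p c∈p a≢b b≢c a≢c
    where open Distinct₃ t

  node-constraints : ∀ (g : Fin m → ℚ) → (∀ {v a b c} → IsInternal T v → Triple v a b c → InTetrahedron (g a) (g b) (g c)) →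
                     NodeConstraints T (tabulate g)
  node-constraints g tetra v d a b c a∈ b∈ c∈ a≢b b≢c a≢c
    rewrite lookup∘tabulate g a | lookup∘tabulate g b | lookup∘tabulate g c =
      tetra d (record { a∈p = a∈ ; b∈p = b∈ ; c∈p = c∈ ; a≢b = a≢b ; b≢c = b≢c ; a≢c = a≢c })

  private
    module Confined {e} (src-leaf : IsLeaf T (src e)) (tgt-leaf : IsLeaf T (tgt e)) where
      End : Fin n → Set
      End x = x ≡ src e ⊎ x ≡ tgt e

      only-edge : ∀ {x f} → End x → f ∈ incident T x → f ≡ e
      only-edge (inj₁ refl) f∈ = leaf-unique src-leaf f∈ (src∈ e)
      only-edge (inj₂ refl) f∈ = leaf-unique tgt-leaf f∈ (tgt∈ e)

      confined : ∀ {x y} → Walk T x y → End x → End y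
      confined nil end = end
      confined (fwd f p) end with refl ← only-edge end (src∈ f) = confined p (inj₂ refl)
      confined (bwd f p) end with refl ← only-edge end (tgt∈ f) = confined p (inj₁ refl)

    distinct-index : ∀ {k} → k ≢ 1 → (i : Fin k) → ∃ λ j → j ≢ i
    distinct-index {suc zero}    k≢1 _       = contradiction refl k≢1
    distinct-index {suc (suc k)} _   zero    = suc zero , λ ()
    distinct-index {suc (suc k)} _   (suc i) = zero , λ ()

  edge-has-internal-end : m ≢ 1 → ∀ e → ∃ λ v → IsInternal T v × e ∈ incident T v
  edge-has-internal-end m≢1 e with proj₂ t13 (src e) | proj₂ t13 (tgt e)
  ... | inj₂ d        | _             = src e , d , src∈ e
  ... | inj₁ _        | inj₂ d        = tgt e , d , tgt∈ e
  ... | inj₁ src-leaf | inj₁ tgt-leaf with f , f≢e ← distinct-index m≢1 e =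
    contradiction (only-edge (confined (connected (src e) (src f)) (inj₁ refl)) (src∈ f)) f≢e
    where open Confined src-leaf tgt-leaf

  coordinate-bounds : ∀ w → InP T w → ∀ e → 0ℚ ≤ lookup w e × lookup w e ≤ ½
  coordinate-bounds w w∈P e with m ℕ.≟ 1
  ... | yes m≡1 = proj₂ w∈P m≡1 e
  ... | no  m≢1 with v , d , e∈ ← edge-has-internal-end m≢1 e with b , c , t ← ∣p∣≡3⇒Distinct₃ d e∈ =
    tetrahedron-bounds (tetrahedron-at w w∈P d t)

  HalfIntegral : Vec ℚ m → Set
  HalfIntegral w = ∀ e → lookup w e ≡ 0ℚ ⊎ lookup w e ≡ ½

  halfIntegral⇒vertex : ∀ {w} → InP T w → HalfIntegral w → IsVertex T w
  halfIntegral⇒vertex w∈P half = w∈P , λ x y t x∈P y∈P 0<t t<1 w≡ → vec-ext x y λ e →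
    let 0≤x , x≤½ = coordinate-bounds x x∈P e ; 0≤y , y≤½ = coordinate-bounds y y∈P e
    in extreme-coordinate 0<t t<1 0≤x x≤½ 0≤y y≤½ (w≡ e) (half e)

  ½if-point : (Fin m → Bool) → Vec ℚ m
  ½if-point J = tabulate (½if ∘ J)

  ½if-point-halfIntegral : ∀ J → HalfIntegral (½if-point J)
  ½if-point-halfIntegral J e rewrite lookup∘tabulate (½if ∘ J) e with J e
  ... | true  = inj₂ refl
  ... | false = inj₁ refl

  ½if-point∈P : ∀ J → (∀ v → IsInternal T v → ∂ J v ≡ false) → InP T (½if-point J)
  ½if-point∈P J balanced =
    node-constraints (½if ∘ J) (λ {v} {a} {b} {c} d t → even⇒½if-tetrahedron (J a) (J b) (J c) (trans (sym (parity-at d t J)) (balanced v d))) ,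
    λ _ e → subst (λ q → 0ℚ ≤ q × q ≤ ½) (sym (lookup∘tabulate (½if ∘ J) e)) (½if-bounds (J e))

  ½if-point∈P⇒balanced : ∀ J → InP T (½if-point J) → ∀ v → IsInternal T v → ∂ J v ≡ false
  ½if-point∈P⇒balanced J J∈P v d with a , b , c , t ← some-triple d =
    trans (parity-at d t J) (½if-tetrahedron⇒even (J a) (J b) (J c) (subst₃ InTetrahedron
      (lookup∘tabulate (½if ∘ J) a) (lookup∘tabulate (½if ∘ J) b) (lookup∘tabulate (½if ∘ J) c) (tetrahedron-at (½if-point J) J∈P d t)))
    where
    subst₃ : ∀ (P : ℚ → ℚ → ℚ → Set) {a b c a′ b′ c′} → a ≡ a′ → b ≡ b′ → c ≡ c′ → P a b c → P a′ b′ c′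
    subst₃ P refl refl refl p = p

  halfEdges : Vec ℚ m → Fin m → Bool
  halfEdges w e = does (lookup w e ℚ.≟ ½)

  halfEdges-½if-point : ∀ J e → halfEdges (½if-point J) e ≡ J e
  halfEdges-½if-point J e rewrite lookup∘tabulate (½if ∘ J) e with J e
  ... | true  = refl
  ... | false = refl

  halfIntegral⇒½if-point : ∀ {w} → HalfIntegral w → w ≡ ½if-point (halfEdges w)
  halfIntegral⇒½if-point {w} half = vec-ext w _ λ e → trans (recover e) (sym (lookup∘tabulate (½if ∘ halfEdges w) e))
    where
    recover : ∀ e → lookup w e ≡ ½if (halfEdges w e)
    recover e with lookup w e ℚ.≟ ½ | half e
    ... | yes w≡½ | _        = w≡½
    ... | no  _   | inj₁ w≡0 = w≡0
    ... | no  w≢½ | inj₂ w≡½ = contradiction w≡½ w≢½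

  ∂-local : ∀ {D D′ v} → (∀ f → f ∈ incident T v → D f ≡ D′ f) → ∂ D v ≡ ∂ D′ v
  ∂-local {D} {D′} {v} agree = ⊕.sum-cong-≗ local
    where
    local : ∀ f → inc v f ∧ D f ≡ inc v f ∧ D′ f
    local f with inc v f in f∈
    ... | true  = agree f (inc⇒∈ f∈)
    ... | false = refl

  slackAt-local : ∀ {J J′ w v} → (∀ f → f ∈ incident T v → J f ≡ J′ f) → slackAt J w v ≡ slackAt J′ w v
  slackAt-local {J} {J′} {w} {v} agree = cong (1ℚ +_) (ℚΣ.sum-cong-≗ local)
    where
    local : ∀ f → (if inc v f then signed (J f) (w f) else 0ℚ) ≡ (if inc v f then signed (J′ f) (w f) else 0ℚ)
    local f with inc v f in f∈
    ... | true  = cong (λ x → signed x (w f)) (agree f (inc⇒∈ f∈))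
    ... | false = refl

  internal? : ∀ v → Dec (IsInternal T v)
  internal? v = degree T v ℕ.≟ 3

  module NonHalfIntegral {w : Vec ℚ m} (vertex : IsVertex T w) {e₀ : Fin m} (w₀≢0 : lookup w e₀ ≢ 0ℚ) (w₀≢½ : lookup w e₀ ≢ ½) where

    private
      W : Fin m → ℚ
      W = lookup w

      w∈P : InP T w
      w∈P = proj₁ vertex

    single-edge-impossible : m ≡ 1 → ⊥
    single-edge-impossible m≡1 =
      ½≢0 (trans (sym (lookup∘tabulate _ e₀)) (trans (cong (λ x → lookup x e₀) corners-equal) (lookup∘tabulate _ e₀)))
      where
      ½≢0 : ½ ≢ 0ℚ
      ½≢0 ()
      corner : Bool → Vec ℚ m
      corner x = tabulate (λ _ → ½if x)
      no-internal : ∀ v → ¬ IsInternal T v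
      no-internal v d = contradiction (subst (ℕ._≤ 1) d (subst (∣ incident T v ∣ ℕ.≤_) m≡1 (∣p∣≤n (incident T v)))) λ { (ℕ.s≤s ()) }
      corner∈P : ∀ x → InP T (corner x)
      corner∈P x = (λ v d → contradiction d (no-internal v)) ,
                   λ _ e → subst (λ q → 0ℚ ≤ q × q ≤ ½) (sym (lookup∘tabulate _ e)) (½if-bounds x)
      only-edge : ∀ {k} → k ≡ 1 → (i j : Fin k) → i ≡ j
      only-edge refl zero zero = refl
      t : ℚ
      t = W e₀ + W e₀
      interior : 0ℚ < t × t < 1ℚ × W e₀ ≡ t * ½ + (1ℚ - t) * 0ℚ
      interior = interior-point (proj₁ (coordinate-bounds w w∈P e₀)) (proj₂ (coordinate-bounds w w∈P e₀)) w₀≢0 w₀≢½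
      between : ∀ i → W i ≡ t * lookup (corner true) i + (1ℚ - t) * lookup (corner false) i
      between i rewrite only-edge m≡1 i e₀ | lookup∘tabulate (λ _ → ½) e₀ | lookup∘tabulate (λ _ → 0ℚ) e₀ = proj₂ (proj₂ interior)
      corners-equal : corner true ≡ corner false
      corners-equal = proj₂ vertex _ _ t (corner∈P true) (corner∈P false) (proj₁ interior) (proj₁ (proj₂ interior)) between

    module _ (m≢1 : m ≢ 1) where
      open Rooted T acyclic connected (src e₀)

      private
        r : Fin n
        r = src e₀

      module LocalChoice {x e} (d : IsInternal T x) (e∈ : e ∈ incident T x) (β : Bool) where
        private
          b c : Fin m
          b = proj₁ (∣p∣≡3⇒Distinct₃ d e∈)
          c = proj₁ (proj₂ (∣p∣≡3⇒Distinct₃ d e∈))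
          t : Triple x e b c
          t = proj₂ (proj₂ (∣p∣≡3⇒Distinct₃ d e∈))
          open Distinct₃ t
          y z : Bool
          y = proj₁ (choose β (W e) (W b) (W c))
          z = proj₂ (choose β (W e) (W b) (W c))

        J : Fin m → Bool
        J f = if δ f b then y else if δ f c then z else β

        J-e : J e ≡ β
        J-e rewrite dec-false (e ≟ b) a≢b | dec-false (e ≟ c) a≢c = refl

        private
          J-b : J b ≡ y
          J-b rewrite dec-true (b ≟ b) refl = refl
          J-c : J c ≡ z
          J-c rewrite dec-false (c ≟ b) (≢-sym b≢c) | dec-true (c ≟ c) refl = refl

        balanced : ∂ J x ≡ false
        balanced = trans (parity-at d t J) (trans (cong₂ _xor_ J-e (cong₂ _xor_ J-b J-c)) (choose-even β (W e) (W b) (W c)))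

        slack-pos : Available β (W e) → 0ℚ < slackAt J W x
        slack-pos available = subst (0ℚ <_)
          (sym (trans (slackAt-triple d t J W) (cong₂ (λ p q → slack p (proj₁ q) (proj₂ q) (W e) (W b) (W c)) J-e (cong₂ _,_ J-b J-c))))
          (choose-slack β (W e) (W b) (W c) available)

        available : Available β (W e) → ∀ {f} → f ∈ incident T x → Available (J f) (W f)
        available β-available f∈ = at (∣p∣≡3⇒exhaustive d t f∈)
          where
          all-available : Available β (W e) × Available y (W b) × Available z (W c)
          all-available = slack⇒all-available β y z (tetrahedron-at w w∈P d t) (choose-even β (W e) (W b) (W c))
                                              (choose-slack β (W e) (W b) (W c) β-available)
          at : ∀ {f} → f ≡ e ⊎ f ≡ b ⊎ f ≡ c → Available (J f) (W f)
          at (inj₁ refl)        = subst (λ p → Available p (W e)) (sym J-e) (proj₁ all-available)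
          at (inj₂ (inj₁ refl)) = subst (λ p → Available p (W b)) (sym J-b) (proj₁ (proj₂ all-available))
          at (inj₂ (inj₂ refl)) = subst (λ p → Available p (W c)) (sym J-c) (proj₂ (proj₂ all-available))

      assign : Fin n → Fin m → Bool → Fin m → Bool
      assign x e β with internal? x | e ∈? incident T x
      ... | yes d | yes e∈ = LocalChoice.J d e∈ β
      ... | _     | _      = λ _ → β

      assign-entry : ∀ x e β → assign x e β e ≡ β
      assign-entry x e β with internal? x | e ∈? incident T x
      ... | yes d | yes e∈ = LocalChoice.J-e d e∈ β
      ... | yes _ | no  _  = refl
      ... | no  _ | _      = refl

      assign-available : ∀ {x e β} → e ∈ incident T x → Available β (W e) → ∀ {f} → f ∈ incident T x → Available (assign x e β f) (W f)
      assign-available {x} {e} {β} e∈ β-available {f} f∈ with internal? x | e ∈? incident T x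
      ... | yes d | yes e∈′ = LocalChoice.available d e∈′ β β-available f∈
      ... | yes _ | no  e∉  = contradiction e∈ e∉
      ... | no ¬d | _ with proj₂ t13 x
      ...   | inj₁ leaf = subst (λ g → Available β (W g)) (leaf-unique leaf e∈ f∈) β-available
      ...   | inj₂ d    = contradiction d ¬d

      assign-good : ∀ {x e β} → IsInternal T x → e ∈ incident T x → Available β (W e) →
                    ∂ (assign x e β) x ≡ false × 0ℚ < slackAt (assign x e β) W x
      assign-good {x} {e} {β} d e∈ β-available with internal? x | e ∈? incident T x
      ... | yes d′ | yes e∈′ = LocalChoice.balanced d′ e∈′ β , LocalChoice.slack-pos d′ e∈′ β β-available
      ... | yes _  | no  e∉  = contradiction e∈ e∉
      ... | no ¬d  | _       = contradiction d ¬d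

      root-available : Available true (W e₀)
      root-available = ≤∧≢⇒< (proj₁ (coordinate-bounds w w∈P e₀)) (≢-sym w₀≢0)

      up : Fin n → Fin m
      up x with x ≟ r
      ... | yes _   = e₀
      ... | no  x≢r = proj₁ (up-exists x x≢r)

      up-spec : ∀ {x} → x ≢ r → inc x (up x) ≡ true × cut (up x) x ≡ true
      up-spec {x} x≢r with x ≟ r
      ... | yes x≡r  = contradiction x≡r x≢r
      ... | no  x≢r′ = proj₂ (up-exists x x≢r′)

      parent : Fin n → Fin n
      parent x = other x (up x)

      up-joins : ∀ {x} → x ≢ r → Joins (up x) x (parent x)
      up-joins x≢r = joins-other (proj₁ (up-spec x≢r))

      parent-shallower : ∀ {x} → x ≢ r → depth x ≡ suc (depth (parent x))
      parent-shallower x≢r = depth-across (up-joins x≢r) (proj₂ (up-spec x≢r))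

      up∈parent : ∀ {x} → x ≢ r → up x ∈ incident T (parent x)
      up∈parent {x} x≢r with up-joins x≢r
      ... | inj₁ (_ , tgt≡) = subst (λ y → up x ∈ incident T y) tgt≡ (tgt∈ (up x))
      ... | inj₂ (src≡ , _) = subst (λ y → up x ∈ incident T y) src≡ (src∈ (up x))

      -- the local choices propagated from the root; the fuel is depth x, so σ x refers to σ (parent x)
      σ′ : ℕ → Fin n → Fin m → Bool
      σ′ zero    _ = assign r e₀ true
      σ′ (suc k) x = if δ x r then assign r e₀ true else assign x (up x) (σ′ k (parent x) (up x))

      σ : Fin n → Fin m → Bool
      σ x = σ′ (depth x) x

      σ-root : σ r ≡ assign r e₀ true
      σ-root rewrite depth-root = refl

      σ-step : ∀ {x} → x ≢ r → σ x ≡ assign x (up x) (σ (parent x) (up x))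
      σ-step {x} x≢r rewrite parent-shallower x≢r | dec-false (x ≟ r) x≢r = refl

      σ-available : ∀ x {f} → f ∈ incident T x → Available (σ x f) (W f)
      σ-available x = go (depth x) x refl
        where
        go : ∀ k x → depth x ≡ k → ∀ {f} → f ∈ incident T x → Available (σ x f) (W f)
        go k x depth≡k {f} f∈ with x ≟ r | k
        ... | yes refl | _ = subst (λ s → Available (s f) (W f)) (sym σ-root) (assign-available (src∈ e₀) root-available f∈)
        ... | no  x≢r | zero = contradiction (trans (sym (parent-shallower x≢r)) depth≡k) λ ()
        ... | no  x≢r | suc k = subst (λ s → Available (s f) (W f)) (sym (σ-step x≢r))
          (assign-available (inc⇒∈ (proj₁ (up-spec x≢r)))
            (go k (parent x) (ℕ.suc-injective (trans (sym (parent-shallower x≢r)) depth≡k)) (up∈parent x≢r)) f∈)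

      J : Fin m → Bool
      J f = σ (child f) f

      J-local : ∀ {x f} → f ∈ incident T x → J f ≡ σ x f
      J-local {x} {f} f∈ with cut f x in below
      ... | true  = cong (λ y → σ y f) (child-unique (∈⇒inc f∈) below)
      ... | false = begin
        σ y f                                   ≡⟨ cong (λ s → s f) (σ-step y≢r) ⟩
        assign y (up y) (σ (parent y) (up y)) f ≡⟨ cong₂ (λ g p → assign y g (σ p g) f) up≡f parent≡x ⟩
        assign y f (σ x f) f                    ≡⟨ assign-entry y f (σ x f) ⟩
        σ x f                                   ∎
        where
        open ≡-Reasoning
        y : Fin n
        y = child f
        y≢r : y ≢ r
        y≢r = cut⇒not-root (child-cut f)
        up≡f : up y ≡ f
        up≡f = up-unique (proj₁ (up-spec y≢r)) (child-inc f) (proj₂ (up-spec y≢r)) (child-cut f)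
        parent≡x : parent y ≡ x
        parent≡x with joins-endpoint (joins-other (child-inc f)) (∈⇒inc f∈)
        ... | inj₁ x≡y = contradiction (trans (sym below) (trans (cong (cut f) x≡y) (child-cut f))) λ ()
        ... | inj₂ x≡other = trans (cong (other y) up≡f) (sym x≡other)

      σ-good : ∀ v → IsInternal T v → ∂ (σ v) v ≡ false × 0ℚ < slackAt (σ v) W v
      σ-good v d with v ≟ r
      ... | yes refl = subst (λ s → ∂ s r ≡ false × 0ℚ < slackAt s W r) (sym σ-root) (assign-good d (src∈ e₀) root-available)
      ... | no  v≢r  = subst (λ s → ∂ s v ≡ false × 0ℚ < slackAt s W v) (sym (σ-step v≢r))
        (assign-good d (inc⇒∈ (proj₁ (up-spec v≢r))) (σ-available (parent v) (up∈parent v≢r)))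

      J-good : ∀ v → IsInternal T v → ∂ J v ≡ false × 0ℚ < slackAt J W v
      J-good v d = trans (∂-local local) (proj₁ (σ-good v d)) , subst (0ℚ <_) (sym (slackAt-local local)) (proj₂ (σ-good v d))
        where
        local : ∀ f → f ∈ incident T v → J f ≡ σ v f
        local f = J-local

      -- clip discards the meaningless slacks at leaves
      ε : ℚ
      ε = minimum (λ v → clip (slackAt J W v))

      ε-pos : 0ℚ < ε
      ε-pos = minimum-pos _ (λ v → clip-pos (slackAt J W v))

      ε≤slack : ∀ {v} → IsInternal T v → ε ≤ slackAt J W v
      ε≤slack {v} d = subst (ε ≤_) (clip-≡ (proj₂ (J-good v d))) (minimum-≤ _ v)

      shifted : ℚ → Vec ℚ m
      shifted t = tabulate (λ e → affine t (W e) (½if (J e)))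

      shifted∈P : InP T (shifted ε) × InP T (shifted (- ε))
      shifted∈P = (node-constraints _ (λ d t → proj₁ (local d t)) , single-edge) ,
                  (node-constraints _ (λ d t → proj₂ (local d t)) , single-edge)
        where
        single-edge : ∀ {P : Set} → m ≡ 1 → P
        single-edge m≡1 = contradiction m≡1 m≢1
        local : ∀ {v a b c} → IsInternal T v → Triple v a b c →
                InTetrahedron (affine ε (W a) (½if (J a))) (affine ε (W b) (½if (J b))) (affine ε (W c) (½if (J c))) ×
                InTetrahedron (affine (- ε) (W a) (½if (J a))) (affine (- ε) (W b) (½if (J b))) (affine (- ε) (W c) (½if (J c)))
        local {v} {a} {b} {c} d t =
          perturb (J a) (J b) (J c) (tetrahedron-at w w∈P d t) (trans (sym (parity-at d t J)) (proj₁ (J-good v d)))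
                  (ℚ.<⇒≤ ε-pos) (minimum-≤1 (λ v → clip (slackAt J W v))) (subst (ε ≤_) (slackAt-triple d t J W) (ε≤slack d))

      impossible : ⊥
      impossible = [ w₀≢0 , w₀≢½ ]′ (subst (λ q → q ≡ 0ℚ ⊎ q ≡ ½) (sym w₀≡u₀) (½if-cases (J e₀)))
        where
        same : shifted (- ε) ≡ shifted ε
        same = proj₂ vertex _ _ ½ (proj₂ shifted∈P) (proj₁ shifted∈P) 0<½ ½<1 λ e →
          trans (affine-midpoint ε (W e) (½if (J e)))
                (sym (cong₂ (λ p q → ½ * p + (1ℚ - ½) * q) (lookup∘tabulate _ e) (lookup∘tabulate _ e)))
        w₀≡u₀ : W e₀ ≡ ½if (J e₀)
        w₀≡u₀ = affine-injective ε-pos (trans (sym (lookup∘tabulate _ e₀)) (trans (cong (λ x → lookup x e₀) same) (lookup∘tabulate _ e₀)))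

  vertex⇒halfIntegral : ∀ {w} → IsVertex T w → HalfIntegral w
  vertex⇒halfIntegral {w} vertex e with lookup w e ℚ.≟ 0ℚ | lookup w e ℚ.≟ ½
  ... | yes w≡0 | _       = inj₁ w≡0
  ... | no  _   | yes w≡½ = inj₂ w≡½
  ... | no  w≢0 | no  w≢½ with m ℕ.≟ 1
  ...   | yes m≡1 = ⊥-elim (NonHalfIntegral.single-edge-impossible {w} vertex {e} w≢0 w≢½ m≡1)
  ...   | no  m≢1 = ⊥-elim (NonHalfIntegral.impossible {w} vertex {e} w≢0 w≢½ m≢1)

  vertex⇒½if-point : ∀ {w} → IsVertex T w → w ≡ ½if-point (halfEdges w)
  vertex⇒½if-point {w} vertex = halfIntegral⇒½if-point {w} (vertex⇒halfIntegral {w} vertex)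

module Bijections (T : Graph) (t13 : Is13Tree T) where
  open import Data.Nat.Base using (_+_; _*_; _^_; _/_; pred)
  open import Data.Nat.DivMod using (m*n/n≡m)
  open import Data.Rational using (ℚ)
  open import Data.Nat.Solver using (module +-*-Solver)
  open +-*-Solver using (solve; _:=_; _:+_; _:*_; con)

  open Graph T
  open Walks T
  open Polytope T t13
  open Forest T acyclic
  open Rooted T acyclic connected (fromℕ< (proj₁ (proj₁ t13)))

  vertex-balanced : ∀ {w} → IsVertex T w → ∀ v → IsInternal T v → ∂ (halfEdges w) v ≡ false
  vertex-balanced {w} vertex = ½if-point∈P⇒balanced (halfEdges w) (subst (InP T) (vertex⇒½if-point {w} vertex) (proj₁ vertex))

  internal⇒not-leaf : ∀ {v} → IsInternal T v → ¬ IsLeaf T v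
  internal⇒not-leaf d leaf with () ← trans (sym d) leaf

  boundary-leaves : ∀ D → (∀ v → IsInternal T v → ∂ D v ≡ false) → ∀ v → v ∈ tabulate (∂ D) → IsLeaf T v
  boundary-leaves D balanced v v∈ with proj₂ t13 v
  ... | inj₁ leaf = leaf
  ... | inj₂ d with () ← trans (sym (balanced v d)) (trans (sym (lookup∘tabulate (∂ D) v)) ([]=⇒lookup v∈))

  boundary-even : ∀ D → 2 ∣ ∣ tabulate (∂ D) ∣
  boundary-even D = Equivalence.from (even⇔parity≡false (tabulate (∂ D))) (trans (⊕.sum-cong-≗ (lookup∘tabulate (∂ D))) (∂-even D))

  leavesOf : VertexSet T → EvenLeafSubset T
  leavesOf (w , vertex) = tabulate (∂ (halfEdges w)) , boundary-leaves _ (vertex-balanced {w} vertex) , boundary-even _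

  ∂-join-leaves : ((S , _) : EvenLeafSubset T) → ∀ v → ∂ (join (lookup S)) v ≡ lookup S v
  ∂-join-leaves (S , _ , even) = ∂-join (lookup S) (Equivalence.to (even⇔parity≡false S) even)

  join-balanced : (s : EvenLeafSubset T) → ∀ v → IsInternal T v → ∂ (join (lookup (proj₁ s))) v ≡ false
  join-balanced s@(S , leaves , _) v d with lookup S v in v∈S
  ... | false = trans (∂-join-leaves s v) v∈S
  ... | true  = contradiction (leaves v (lookup⇒[]= v S v∈S)) (internal⇒not-leaf d)

  pointOf : Subset n → Vec ℚ m
  pointOf S = ½if-point (join (lookup S))

  vertexOf : EvenLeafSubset T → VertexSet T
  vertexOf s = pointOf (proj₁ s) ,
    halfIntegral⇒vertex {pointOf (proj₁ s)} (½if-point∈P _ (join-balanced s)) (½if-point-halfIntegral (join (lookup (proj₁ s))))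

  vertices↔evenLeafSubsets : Bij (VertexSet T) (EvenLeafSubset T) proj₁ proj₁
  vertices↔evenLeafSubsets = record { to = leavesOf ; from = vertexOf ; from-to = from-to ; to-from = to-from }
    where
    from-to : ∀ ((w , vertex) : VertexSet T) → pointOf (tabulate (∂ (halfEdges w))) ≡ w
    from-to (w , vertex) = trans (tabulate-cong (cong ½if ∘ recovered)) (sym (vertex⇒½if-point {w} vertex))
      where
      recovered : ∀ e → join (lookup (tabulate (∂ (halfEdges w)))) e ≡ halfEdges w e
      recovered e = trans (⊕.sum-cong-≗ λ v → cong (cut e v ∧_) (lookup∘tabulate (∂ (halfEdges w)) v)) (join-∂ (halfEdges w) e)
    to-from : ∀ ((S , _) : EvenLeafSubset T) → tabulate (∂ (halfEdges (pointOf S))) ≡ S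
    to-from s@(S , _) = trans (tabulate-cong λ v → trans (∂-local λ e _ → halfEdges-½if-point (join (lookup S)) e) (∂-join-leaves s v))
                              (tabulate∘lookup S)

  leaf? : ∀ v → Dec (IsLeaf T v)
  leaf? v = degree T v ℕ.≟ 1

  leaves : Subset n
  leaves = tabulate (does ∘ leaf?)

  leaves-handshake : ∣ leaves ∣ + ∣ leaves ∣ ≡ 3 + m
  leaves-handshake = ℕ.+-cancelˡ-≡ (m * 2) _ _ (begin
    m * 2 + (∣ leaves ∣ + ∣ leaves ∣)
      ≡⟨ cong₂ (λ a b → a + (b + b)) (sym degree-sum) ∣leaves∣≡ ⟩
    ℕΣ.sum (degree T) + (ℕΣ.sum 𝟙 + ℕΣ.sum 𝟙)
      ≡⟨ cong (ℕΣ.sum (degree T) +_) (sym (ℕΣ.∑-distrib-+ 𝟙 𝟙)) ⟩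
    ℕΣ.sum (degree T) + ℕΣ.sum (λ v → 𝟙 v + 𝟙 v)
      ≡⟨ sym (ℕΣ.∑-distrib-+ (degree T) _) ⟩
    ℕΣ.sum (λ v → degree T v + (𝟙 v + 𝟙 v))
      ≡⟨ ℕΣ.sum-cong-≗ degree+2·leaf ⟩
    ℕΣ.sum {n} (λ _ → 3)
      ≡⟨ sum-const {n} 3 ⟩
    n * 3
      ≡⟨ cong (_* 3) (sym suc-edges≡vertices) ⟩
    suc m * 3
      ≡⟨ solve 1 (λ m → (con 1 :+ m) :* con 3 := m :* con 2 :+ (con 3 :+ m)) refl m ⟩
    m * 2 + (3 + m)                                 ∎)
    where
    open ≡-Reasoning
    𝟙 : Fin n → ℕ
    𝟙 v = if does (leaf? v) then 1 else 0
    ∣leaves∣≡ : ∣ leaves ∣ ≡ ℕΣ.sum 𝟙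
    ∣leaves∣≡ = trans (∣S∣≡sum leaves) (ℕΣ.sum-cong-≗ λ v → cong (λ b → if b then 1 else 0) (lookup∘tabulate (does ∘ leaf?) v))
    degree+2·leaf : ∀ v → degree T v + (𝟙 v + 𝟙 v) ≡ 3
    degree+2·leaf v with proj₂ t13 v
    ... | inj₁ leaf = cong₂ (λ k b → k + (b + b)) leaf (cong (λ b → if b then 1 else 0) (dec-true (leaf? v) leaf))
    ... | inj₂ d    = cong₂ (λ k b → k + (b + b)) d (cong (λ b → if b then 1 else 0) (dec-false (leaf? v) (internal⇒not-leaf d)))

  pred-half : ∀ ℓ → ℓ + ℓ ≡ 3 + m → pred ℓ ≡ (m + 1) / 2
  pred-half (suc ℓ) eq = sym (trans (cong (_/ 2) m+1≡ℓ*2) (m*n/n≡m ℓ 2))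
    where
    m+1≡ℓ*2 : m + 1 ≡ ℓ * 2
    m+1≡ℓ*2 = trans (ℕ.+-comm m 1) (trans (sym (ℕ.suc-injective (trans (sym (ℕ.+-suc ℓ ℓ)) (ℕ.suc-injective eq))))
                (solve 1 (λ l → l :+ l := l :* con 2) refl ℓ))

  vertices↔Fin : Bij (VertexSet T) (Fin (2 ^ ((m + 1) / 2))) proj₁ id
  vertices↔Fin = subst (λ k → Bij (VertexSet T) (Fin (2 ^ k)) proj₁ id) (pred-half ∣ leaves ∣ leaves-handshake)
    (Bij-∘ vertices↔evenLeafSubsets (evenSubsetOf↔Fin leaf?) (cong pointOf) (cong (evenToFin ∘ restrict leaves)))

open import Data.Nat using (_^_; _+_; _/_)

corollary1 : (T : Graph) → Is13Tree T →
    Bij (VertexSet T) (EvenLeafSubset T) proj₁ proj₁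
    × Bij (VertexSet T) (Fin (2 ^ ((Graph.m T + 1) / 2))) proj₁ id
corollary1 T t13 = vertices↔evenLeafSubsets , vertices↔Fin
  where open Bijections T t13
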